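{- Let $z$ be a formal parameter. For a partition $\lambda=(\lambda_1,\ldots,\lambda_\ell)$ of size $n$, set $\varphi_\lambda(z)=\prod_{i=1}^{n}(z+n+\lambda_i-i)$, where $\lambda_i=0$ for $i\ge\ell+1$ (so $\varphi_\emptyset=1$). Then for each partition $\lambda$, $$D\Bigl(\frac{\varphi_\lambda(z)}{H_\lambda}\Bigr)=\frac{z\,\varphi_\lambda(z+1)}{H_\lambda}.$$
   Context: $h_\square$ is the hook length of a box of the Young diagram (arm + leg + 1), $H_\lambda=\prod_{\square\in\lambda}h_\square$, $H_\emptyset=1$. For a function $g$ on partitions (here with values in $\mathbb{Q}[z]$), $Dg(\lambda)=\sum_{\lambda^+}g(\lambda^+)-g(\lambda)$, where $\lambda^+$ ranges over partitions obtained from $\lambda$ by adding one box (with $\varphi_{\lambda^+}$ computed using size $n+1$). -}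

module Defs where

open import Data.Bool using (Bool; true; false; if_then_else_)
open import Data.Maybe using (Maybe; just; nothing)
open import Data.Nat as ℕ using (ℕ; zero; suc; _<_; _≥_; _∸_; _<ᵇ_)
open import Data.List using (List; []; _∷_; [_]; _++_; map; foldr; length; filter; upTo; concatMap)
open import Data.Nat.ListAction using (sum; product)
open import Data.List.Relation.Unary.All using (All)
open import Data.List.Relation.Unary.Linked using (Linked)
open import Data.Integer as ℤ using (ℤ; +_)
open import Data.Rational as ℚ using (ℚ; _/_)

record Partition : Set where
  constructor mkPartition
  field
    parts     : List ℕ
    decreasing : Linked _≥_ parts
    positive  : All (λ x → 0 < x) parts
open Partition public

size : List ℕ → ℕ
size = sum

-- λ_i with 0-based index i, and λ_i = 0 beyond the length
part : List ℕ → ℕ → ℕ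
part []       _       = 0
part (x ∷ _)  zero    = x
part (_ ∷ xs) (suc i) = part xs i

conj : List ℕ → ℕ → ℕ
conj []       j = 0
conj (x ∷ xs) j = (if j <ᵇ x then 1 else 0) ℕ.+ conj xs j

-- hook length of box (i , j) (0-based row i, column j, with j < λ_i):
-- arm + leg + 1 = (λ_i - j - 1) + (λ'_j - i - 1) + 1
hook : List ℕ → ℕ → ℕ → ℕ
hook l i j = ((part l i ∸ j) ℕ.+ (conj l j ∸ i)) ∸ 1

H : List ℕ → ℕ
H l = product (concatMap (λ i → map (λ j → hook l i j) (upTo (part l i))) (upTo (length l)))

-- all partitions obtained by adding one box:
-- row i may grow iff i = 0 or λ_{i-1} > λ_i; additionally a new row of length 1.
addBoxesFrom : Maybe ℕ → List ℕ → List (List ℕ)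
addBoxesFrom _ [] = [ [ 1 ] ]
addBoxesFrom p (x ∷ xs) =
  (if canGrow p then [ suc x ∷ xs ] else []) ++ map (x ∷_) (addBoxesFrom (just x) xs)
  where
  canGrow : Maybe ℕ → Bool
  canGrow nothing  = true
  canGrow (just y) = x <ᵇ y

addBoxes : List ℕ → List (List ℕ)
addBoxes = addBoxesFrom nothing

ℤtoℚ : ℤ → ℚ
ℤtoℚ k = k / 1

sumℚ : List ℚ → ℚ
sumℚ = foldr ℚ._+_ ℚ.0ℚ

prodℚ : List ℚ → ℚ
prodℚ = foldr ℚ._*_ ℚ.1ℚ

-- division of a rational by a natural number; only used with positive
-- denominators (H_λ ≥ 1), where it is ordinary division.
_÷ℕ_ : ℚ → ℕ → ℚ
q ÷ℕ zero    = ℚ.0ℚ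
q ÷ℕ (suc k) = q ℚ.* (+ 1 / suc k)

-- φ_λ(z) = ∏_{i=1}^{n} (z + n + λ_i - i), n = |λ|  (written with 0-based i' = i - 1)
φ : List ℕ → ℚ → ℚ
φ l z = prodℚ (map (λ i → z ℚ.+ ℤtoℚ ((+ (size l ℕ.+ part l i)) ℤ.- (+ suc i))) (upTo (size l)))

D : (List ℕ → ℚ) → List ℕ → ℚ
D g l = sumℚ (map g (addBoxes l)) ℚ.- g l

module Submission where

-- Index the rows of λ ⊢ n by the β-numbers b i = λ i + n − i (i ≤ n), a strictly decreasing
-- sequence with b n = 0, so that φ λ z = ∏_{i<n} (z + b i − 1) and z φ λ (z + 1) = ∏_{i≤n} (z + b i).
-- Frobenius' formula H λ · ∏_{i<j} (b i − b j) = ∏ (b i)! rewrites φ μ z / H μ for |μ| = n + 1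
-- as a function F of the β-numbers of μ.  Adding a box to row k raises b k by one, and
-- raising a b k onto b (k − 1) makes the Vandermonde product vanish, so the sum over λ⁺ is a
-- sum of F over all k ≤ n.  Up to the common factor Δ(b)/∏ (b i)!, its k-th term is a Lagrange
-- weight of the monic polynomial ∏_{i<n} (u + b i − 1) at the nodes −b k, times
-- ∏_{i≤n} (z + b i) + ∏_{i≤n, i≠k} (z + b i); the two Lagrange identities (the weights sum
-- to 1, and the weighted basis polynomials sum to the polynomial) leave (z φ λ (z + 1) + φ λ z) / H λ.

open import Algebra.Bundles using (CommutativeSemigroup)
open import Algebra.Structures using (IsCommutativeMonoid)
import Algebra.Properties.CommutativeSemigroup as CommutativeSemigroupProperties
open import Data.Bool using (true; false; T)
open import Data.Bool.Properties using (T-≡)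
open import Data.Empty using (⊥-elim)
import Data.Integer as ℤ
import Data.Integer.Properties as ℤP
open import Data.List using (List; []; _∷_; [_]; _++_; length; map; foldr; concatMap; applyUpTo)
open import Data.List.Properties using (map-∘; map-cong; map-cong-local)
open import Data.List.Relation.Unary.All as All using (All; []; _∷_)
import Data.List.Relation.Unary.All.Properties as All
open import Data.List.Relation.Unary.Linked using (Linked; _∷_)
open import Data.Maybe using (Maybe; just; nothing)
open import Data.Nat as ℕ using (ℕ; zero; suc; _≤_; _<_; _≥_; _≟_; z≤n; s≤s; _!; _<ᵇ_)
import Data.Nat.Coprimality as Coprimality
open import Data.Nat.ListAction using (product)
open import Data.Nat.ListAction.Properties using (product-++)
import Data.Nat.Properties as ℕP
open import Data.Nat.Properties
  using (≤-refl; ≤-trans; <⇒≤; <⇒≱; <⇒<ᵇ; <-irrefl; ≤∧≢⇒<; ≤-pred; m<n⇒m<1+n; +-suc; +-identityʳ; +-comm; *-comm)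
import Data.Nat.Solver as ℕSolver
open import Data.Product using (_×_; _,_; proj₁; proj₂)
open import Data.Rational as ℚ using (ℚ; 0ℚ; 1ℚ)
import Data.Rational.Properties as ℚP
import Data.Rational.Solver as ℚSolver
open import Data.Unit using (⊤; tt)
open import Function using (_∘_; Equivalence)
open import Relation.Binary.Definitions using (tri<; tri≈; tri>)
open import Relation.Binary.PropositionalEquality
  using (_≡_; _≢_; refl; sym; trans; cong; cong₂; subst; module ≡-Reasoning)
open import Relation.Nullary using (Dec; yes; no)

open import Algebra.Properties.Group ℚP.+-0-group using (x∙y⁻¹≈ε⇒x≈y)

open import Defs

module RangeFold {A : Set} {_∙_ : A → A → A} {ε : A}
                 (isCommutativeMonoid : IsCommutativeMonoid _≡_ _∙_ ε) where

  open IsCommutativeMonoid isCommutativeMonoid using (assoc; identityˡ; identityʳ; isCommutativeSemigroup)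
  commutativeSemigroup : CommutativeSemigroup _ _
  commutativeSemigroup = record { isCommutativeSemigroup = isCommutativeSemigroup }

  open CommutativeSemigroupProperties commutativeSemigroup using (interchange; xy∙z≈xz∙y)
  open ≡-Reasoning

  fold : ℕ → (ℕ → A) → A
  fold zero    f = ε
  fold (suc n) f = fold n f ∙ f n

  fold-cong : ∀ n {f g : ℕ → A} → (∀ i → i < n → f i ≡ g i) → fold n f ≡ fold n g
  fold-cong zero    f≗g = refl
  fold-cong (suc n) f≗g = cong₂ _∙_ (fold-cong n (λ i i<n → f≗g i (m<n⇒m<1+n i<n))) (f≗g n ≤-refl)

  fold-suc : ∀ n (f : ℕ → A) → fold (suc n) f ≡ f 0 ∙ fold n (f ∘ suc)
  fold-suc zero    f = trans (identityˡ (f 0)) (sym (identityʳ (f 0)))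
  fold-suc (suc n) f = trans (cong (_∙ f (suc n)) (fold-suc n f)) (assoc (f 0) _ _)

  fold-+ : ∀ m n (f : ℕ → A) → fold (m ℕ.+ n) f ≡ fold m f ∙ fold n (λ i → f (m ℕ.+ i))
  fold-+ m zero    f rewrite +-identityʳ m = sym (identityʳ (fold m f))
  fold-+ m (suc n) f rewrite +-suc m n =
    trans (cong (_∙ f (m ℕ.+ n)) (fold-+ m n f)) (assoc (fold m f) _ _)

  fold-distrib : ∀ n (f g : ℕ → A) → fold n (λ i → f i ∙ g i) ≡ fold n f ∙ fold n g
  fold-distrib zero    f g = sym (identityˡ ε)
  fold-distrib (suc n) f g =
    trans (cong (_∙ (f n ∙ g n)) (fold-distrib n f g)) (interchange (fold n f) (fold n g) (f n) (g n))

  fold-ε : ∀ n {f : ℕ → A} → (∀ i → i < n → f i ≡ ε) → fold n f ≡ ε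
  fold-ε zero    f≗ε = refl
  fold-ε (suc n) f≗ε =
    trans (cong₂ _∙_ (fold-ε n (λ i i<n → f≗ε i (m<n⇒m<1+n i<n))) (f≗ε n ≤-refl)) (identityˡ ε)

  except : ℕ → (ℕ → A) → ℕ → A
  except k f i with i ≟ k
  ... | yes _ = ε
  ... | no  _ = f i

  except-self : ∀ k (f : ℕ → A) → except k f k ≡ ε
  except-self k f with k ≟ k
  ... | yes _   = refl
  ... | no  k≢k = ⊥-elim (k≢k refl)

  except-≢ : ∀ {k i} (f : ℕ → A) → i ≢ k → except k f i ≡ f i
  except-≢ {k} {i} f i≢k with i ≟ k
  ... | yes i≡k = ⊥-elim (i≢k i≡k)
  ... | no  _   = refl

  fold-except-cong : ∀ k n {f g : ℕ → A} → (∀ i → i < n → i ≢ k → f i ≡ g i) →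
                     fold n (except k f) ≡ fold n (except k g)
  fold-except-cong k n {f} {g} f≗g = fold-cong n (λ i i<n → by-cases i i<n (i ≟ k))
    where
    by-cases : ∀ i → i < n → Dec (i ≡ k) → except k f i ≡ except k g i
    by-cases i _   (yes refl) = trans (except-self k f) (sym (except-self k g))
    by-cases i i<n (no  i≢k)  = trans (except-≢ f i≢k) (trans (f≗g i i<n i≢k) (sym (except-≢ g i≢k)))

  fold-except-suc : ∀ {k} n (f : ℕ → A) → n ≢ k → fold (suc n) (except k f) ≡ fold n (except k f) ∙ f n
  fold-except-suc n f n≢k = cong (fold n (except _ f) ∙_) (except-≢ f n≢k)

  fold-except-beyond : ∀ {k} n (f : ℕ → A) → n ≤ k → fold n (except k f) ≡ fold n f
  fold-except-beyond zero    f n≤k = refl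
  fold-except-beyond (suc n) f n<k =
    trans (fold-except-suc n f (λ n≡k → <-irrefl n≡k n<k)) (cong (_∙ f n) (fold-except-beyond n f (<⇒≤ n<k)))

  fold-except-last : ∀ n (f : ℕ → A) → fold (suc n) (except n f) ≡ fold n f
  fold-except-last n f =
    trans (cong₂ _∙_ (fold-except-beyond n f ≤-refl) (except-self n f)) (identityʳ (fold n f))

  fold-split-at : ∀ {k} n (f : ℕ → A) → k < n → fold n f ≡ fold n (except k f) ∙ f k
  fold-split-at {k} (suc n) f k<1+n with k ≟ n
  ... | yes refl = sym (cong (_∙ f k) (fold-except-last k f))
  ... | no  k≢n  = begin
    fold n f ∙ f n                        ≡⟨ cong (_∙ f n) (fold-split-at n f (≤∧≢⇒< (≤-pred k<1+n) k≢n)) ⟩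
    (fold n (except k f) ∙ f k) ∙ f n     ≡⟨ xy∙z≈xz∙y _ (f k) (f n) ⟩
    (fold n (except k f) ∙ f n) ∙ f k     ≡⟨ cong (_∙ f k) (fold-except-suc n f (k≢n ∘ sym)) ⟨
    fold (suc n) (except k f) ∙ f k       ∎

  fold-pairs : ℕ → (ℕ → ℕ → A) → A
  fold-pairs n d = fold n (λ j → fold j (λ i → d i j))

  fold-pairs-suc : ∀ n (d : ℕ → ℕ → A) →
    fold-pairs (suc n) d ≡ fold n (λ j → d 0 (suc j)) ∙ fold-pairs n (λ i j → d (suc i) (suc j))
  fold-pairs-suc n d = begin
    fold (suc n) (λ j → fold j (λ i → d i j))
      ≡⟨ fold-suc n _ ⟩
    ε ∙ fold n (λ j → fold (suc j) (λ i → d i (suc j)))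
      ≡⟨ identityˡ _ ⟩
    fold n (λ j → fold (suc j) (λ i → d i (suc j)))
      ≡⟨ fold-cong n (λ j _ → fold-suc j (λ i → d i (suc j))) ⟩
    fold n (λ j → d 0 (suc j) ∙ fold j (λ i → d (suc i) (suc j)))
      ≡⟨ fold-distrib n _ _ ⟩
    fold n (λ j → d 0 (suc j)) ∙ fold-pairs n (λ i j → d (suc i) (suc j)) ∎

  fold-map-applyUpTo : ∀ {B : Set} n (f : B → A) (g : ℕ → B) → foldr _∙_ ε (map f (applyUpTo g n)) ≡ fold n (f ∘ g)
  fold-map-applyUpTo zero    f g = refl
  fold-map-applyUpTo (suc n) f g =
    trans (cong (f (g 0) ∙_) (fold-map-applyUpTo n f (g ∘ suc))) (sym (fold-suc n (f ∘ g)))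

open RangeFold ℕP.*-1-isCommutativeMonoid using ()
  renaming ( fold to ∏ℕ; fold-cong to ∏ℕ-cong; fold-suc to ∏ℕ-suc; fold-+ to ∏ℕ-+
           ; fold-map-applyUpTo to product-map-applyUpTo; fold-pairs to ∏ℕ-pairs; fold-pairs-suc to ∏ℕ-pairs-suc)

∏ℕ-positive : ∀ n {f : ℕ → ℕ} → (∀ i → 0 < f i) → 0 < ∏ℕ n f
∏ℕ-positive zero    f>0 = s≤s z≤n
∏ℕ-positive (suc n) f>0 = ℕP.*-mono-≤ (∏ℕ-positive n f>0) (f>0 n)

module HookFormula where

  open import Data.Nat using (_+_; _*_; _∸_)
  open ℕSolver.+-*-Solver
  open ≡-Reasoning

  Decreasing : List ℕ → Set
  Decreasing []       = ⊤
  Decreasing (x ∷ xs) = part xs 0 ≤ x × Decreasing xs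

  linked⇒decreasing : ∀ l → Linked _≥_ l → Decreasing l
  linked⇒decreasing []           _             = tt
  linked⇒decreasing (x ∷ [])     _             = z≤n , tt
  linked⇒decreasing (x ∷ y ∷ xs) (x≥y ∷ y∷xs↓) = x≥y , linked⇒decreasing (y ∷ xs) y∷xs↓

  part≤head : ∀ xs → Decreasing xs → ∀ i → part xs i ≤ part xs 0
  part≤head []       _          i       = z≤n
  part≤head (x ∷ xs) _          zero    = ≤-refl
  part≤head (x ∷ xs) (x₁≤x , d) (suc i) = ≤-trans (part≤head xs d i) x₁≤x

  part-antitone : ∀ l → Decreasing l → ∀ {i j} → i ≤ j → part l j ≤ part l i
  part-antitone []       _          _               = z≤n
  part-antitone (x ∷ l)  _          {zero} {zero}   _         = ≤-refl
  part-antitone (x ∷ l)  (x₁≤x , d) {zero} {suc j}  _         = ≤-trans (part≤head l d j) x₁≤x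
  part-antitone (x ∷ l)  (_ , d)    {suc i} {suc j} (s≤s i≤j) = part-antitone l d i≤j

  conj-beyond : ∀ ys → Decreasing ys → ∀ j → part ys 0 ≤ j → conj ys j ≡ 0
  conj-beyond []       _          j _   = refl
  conj-beyond (y ∷ ys) (y₁≤y , d) j y≤j with j <ᵇ y in j<ᵇy
  ... | true  = ⊥-elim (<⇒≱ (ℕP.<ᵇ⇒< j y (Equivalence.from T-≡ j<ᵇy)) y≤j)
  ... | false = conj-beyond ys d j (≤-trans y₁≤y y≤j)

  conj-cons-< : ∀ {y j} ys → j < y → conj (y ∷ ys) j ≡ suc (conj ys j)
  conj-cons-< ys j<y rewrite Equivalence.to T-≡ (<⇒<ᵇ j<y) = refl

  hook-first-row : ∀ {x j} xs → j < x → hook (x ∷ xs) 0 j ≡ (x ∸ j) + conj xs j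
  hook-first-row {x} {j} xs j<x rewrite Equivalence.to T-≡ (<⇒<ᵇ j<x) | +-suc (x ∸ j) (conj xs j) = refl

  hook-lower-row : ∀ {x j} xs i → j < x → hook (x ∷ xs) (suc i) j ≡ hook xs i j
  hook-lower-row xs i j<x rewrite Equivalence.to T-≡ (<⇒<ᵇ j<x) = refl

  product-concatMap : ∀ n (F : ℕ → List ℕ) (g : ℕ → ℕ) →
                      product (concatMap F (applyUpTo g n)) ≡ ∏ℕ n (λ i → product (F (g i)))
  product-concatMap zero    F g = refl
  product-concatMap (suc n) F g = begin
    product (F (g 0) ++ concatMap F (applyUpTo (g ∘ suc) n))    ≡⟨ product-++ (F (g 0)) _ ⟩
    product (F (g 0)) * product (concatMap F (applyUpTo (g ∘ suc) n))
      ≡⟨ cong (product (F (g 0)) *_) (product-concatMap n F (g ∘ suc)) ⟩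
    product (F (g 0)) * ∏ℕ n (λ i → product (F (g (suc i))))  ≡⟨ ∏ℕ-suc n _ ⟨
    ∏ℕ (suc n) (λ i → product (F (g i)))                       ∎

  H-∏ : ∀ l → H l ≡ ∏ℕ (length l) (λ i → ∏ℕ (part l i) (hook l i))
  H-∏ l = trans (product-concatMap (length l) _ (λ i → i))
                (∏ℕ-cong (length l) (λ i _ → product-map-applyUpTo (part l i) (hook l i) (λ j → j)))

  rowHooks : ℕ → ℕ → List ℕ → ℕ
  rowHooks X y ys = ∏ℕ y (λ j → (X ∸ j) + conj ys j)

  H-cons : ∀ x xs → Decreasing (x ∷ xs) → H (x ∷ xs) ≡ rowHooks x x xs * H xs
  H-cons x xs (x₁≤x , d) = begin
    H (x ∷ xs)
      ≡⟨ H-∏ (x ∷ xs) ⟩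
    ∏ℕ (suc (length xs)) (λ i → ∏ℕ (part (x ∷ xs) i) (hook (x ∷ xs) i))
      ≡⟨ ∏ℕ-suc (length xs) _ ⟩
    ∏ℕ x (hook (x ∷ xs) 0) * ∏ℕ (length xs) (λ i → ∏ℕ (part xs i) (hook (x ∷ xs) (suc i)))
      ≡⟨ cong₂ _*_ (∏ℕ-cong x (λ j j<x → hook-first-row xs j<x))
                   (∏ℕ-cong (length xs) (λ i _ → ∏ℕ-cong (part xs i) (λ j j<xᵢ →
                     hook-lower-row xs i (≤-trans j<xᵢ (≤-trans (part≤head xs d i) x₁≤x))))) ⟩
    rowHooks x x xs * ∏ℕ (length xs) (λ i → ∏ℕ (part xs i) (hook xs i))
      ≡⟨ cong (rowHooks x x xs *_) (H-∏ xs) ⟨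
    rowHooks x x xs * H xs ∎

  falling : ℕ → ℕ → ℕ
  falling A p = ∏ℕ p (λ j → A ∸ j)

  falling-suc : ∀ A p → falling (suc A) (suc p) ≡ suc A * falling A p
  falling-suc A p = ∏ℕ-suc p (λ j → suc A ∸ j)

  falling-+ : ∀ A p q → falling A (p + q) ≡ falling A p * falling (A ∸ p) q
  falling-+ A p q = trans (∏ℕ-+ p q (λ j → A ∸ j)) (cong (falling A p *_) (∏ℕ-cong q (λ t _ → sym (ℕP.∸-+-assoc A p t))))

  falling-self : ∀ A → falling A A ≡ A !
  falling-self zero    = refl
  falling-self (suc A) = trans (falling-suc A A) (cong (suc A *_) (falling-self A))

  ∏-ascending : ∀ M X → ∏ℕ M (λ i → X + suc i) ≡ falling (X + M) M
  ∏-ascending zero    X = refl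
  ∏-ascending (suc M) X rewrite +-suc X M = begin
    ∏ℕ M (λ i → X + suc i) * suc (X + M)   ≡⟨ cong (_* suc (X + M)) (∏-ascending M X) ⟩
    falling (X + M) M * suc (X + M)        ≡⟨ *-comm _ (suc (X + M)) ⟩
    suc (X + M) * falling (X + M) M        ≡⟨ falling-suc (X + M) M ⟨
    falling (suc (X + M)) (suc M)          ∎

  gaps : ℕ → ℕ → List ℕ → ℕ
  gaps X M ys = ∏ℕ M (λ i → (X + suc i) ∸ part ys i)

  rowHooks-cons : ∀ y k d ys → Decreasing (y ∷ ys) →
                  rowHooks (y + k) (y + d) (y ∷ ys) ≡ rowHooks (suc (y + k)) y ys * falling k d
  rowHooks-cons y k d ys y∷ys↓ = begin
    ∏ℕ (y + d) F                              ≡⟨ ∏ℕ-+ y d F ⟩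
    ∏ℕ y F * ∏ℕ d (λ t → F (y + t))           ≡⟨ cong₂ _*_ (∏ℕ-cong y (λ j j<y → upper j j<y)) (∏ℕ-cong d (λ t _ → lower t)) ⟩
    rowHooks (suc (y + k)) y ys * falling k d ∎
    where
    F : ℕ → ℕ
    F j = ((y + k) ∸ j) + conj (y ∷ ys) j
    upper : ∀ j → j < y → F j ≡ (suc (y + k) ∸ j) + conj ys j
    upper j j<y = begin
      ((y + k) ∸ j) + conj (y ∷ ys) j   ≡⟨ cong (((y + k) ∸ j) +_) (conj-cons-< ys j<y) ⟩
      ((y + k) ∸ j) + suc (conj ys j)   ≡⟨ +-suc _ _ ⟩
      suc ((y + k) ∸ j) + conj ys j     ≡⟨ cong (_+ conj ys j) (ℕP.+-∸-assoc 1 (≤-trans (<⇒≤ j<y) (ℕP.m≤m+n y k))) ⟨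
      (suc (y + k) ∸ j) + conj ys j     ∎
    lower : ∀ t → F (y + t) ≡ k ∸ t
    lower t = trans (cong₂ _+_ (ℕP.[m+n]∸[m+o]≡n∸o y k t) (conj-beyond (y ∷ ys) y∷ys↓ (y + t) (ℕP.m≤m+n y t)))
                    (+-identityʳ (k ∸ t))

  gaps-cons : ∀ X M y ys → gaps X (suc M) (y ∷ ys) ≡ (suc X ∸ y) * gaps (suc X) M ys
  gaps-cons X M y ys = trans (∏ℕ-suc M _)
    (cong₂ (λ a b → (a ∸ y) * b) (trans (+-suc X 0) (cong suc (+-identityʳ X)))
                                 (∏ℕ-cong M (λ i _ → cong (_∸ part ys i) (+-suc X (suc i)))))

  -- the first-row hooks and the gaps together are exactly X + M, X + M − 1, …, X − y + 1
  rowHooks*gaps : ∀ ys M X y → Decreasing ys → part ys 0 ≤ y → y ≤ X → length ys ≤ M →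
                  rowHooks X y ys * gaps X M ys ≡ falling (X + M) (y + M)
  rowHooks*gaps [] M X y _ _ y≤X _ = begin
    ∏ℕ y (λ j → (X ∸ j) + 0) * ∏ℕ M (λ i → X + suc i)
      ≡⟨ cong₂ _*_ (∏ℕ-cong y (λ j _ → +-identityʳ (X ∸ j))) (∏-ascending M X) ⟩
    falling X y * falling (X + M) M                 ≡⟨ *-comm (falling X y) _ ⟩
    falling (X + M) M * falling X y                 ≡⟨ cong (λ A → falling (X + M) M * falling A y) (ℕP.m+n∸n≡m X M) ⟨
    falling (X + M) M * falling (X + M ∸ M) y       ≡⟨ falling-+ (X + M) M y ⟨
    falling (X + M) (M + y)                         ≡⟨ cong (falling (X + M)) (+-comm M y) ⟩
    falling (X + M) (y + M)                         ∎
  rowHooks*gaps (y′ ∷ ys) (suc M) X y (ys₀≤y′ , ys↓) y′≤y y≤X (s≤s length≤M)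
    with ℕP.m≤n⇒∃[o]m+o≡n y′≤y | ℕP.m≤n⇒∃[o]m+o≡n (≤-trans y′≤y y≤X)
  ... | d , refl | k , refl = begin
    rowHooks (y′ + k) (y′ + d) (y′ ∷ ys) * gaps (y′ + k) (suc M) (y′ ∷ ys)
      ≡⟨ cong₂ _*_ (rowHooks-cons y′ k d ys (ys₀≤y′ , ys↓)) (gaps-cons (y′ + k) M y′ ys) ⟩
    (R * falling k d) * ((suc (y′ + k) ∸ y′) * G)
      ≡⟨ cong (λ a → (R * falling k d) * (a * G)) (ℕP.+-∸-assoc 1 {y′ + k} (ℕP.m≤m+n y′ k)) ⟩
    (R * falling k d) * (suc ((y′ + k) ∸ y′) * G)
      ≡⟨ cong (λ a → (R * falling k d) * (suc a * G)) (ℕP.m+n∸m≡n y′ k) ⟩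
    (R * falling k d) * (suc k * G)
      ≡⟨ solve 4 (λ r f s g → (r :* f) :* (s :* g) := (r :* g) :* (s :* f)) refl R (falling k d) (suc k) G ⟩
    (R * G) * (suc k * falling k d)
      ≡⟨ cong₂ _*_ (rowHooks*gaps ys M (suc (y′ + k)) y′ ys↓ ys₀≤y′ (ℕP.m≤n⇒m≤1+n (ℕP.m≤m+n y′ k)) length≤M)
                   (sym (falling-suc k d)) ⟩
    falling (suc (y′ + k) + M) (y′ + M) * falling (suc k) (suc d)
      ≡⟨ cong (λ A → falling (suc (y′ + k) + M) (y′ + M) * falling A (suc d)) (sym rest) ⟩
    falling (suc (y′ + k) + M) (y′ + M) * falling (suc (y′ + k) + M ∸ (y′ + M)) (suc d)
      ≡⟨ falling-+ _ (y′ + M) (suc d) ⟨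
    falling (suc (y′ + k) + M) ((y′ + M) + suc d)
      ≡⟨ cong₂ falling (solve 3 (λ y k m → con 1 :+ (y :+ k) :+ m := y :+ k :+ (con 1 :+ m)) refl y′ k M)
                       (solve 3 (λ y m d → y :+ m :+ (con 1 :+ d) := y :+ d :+ (con 1 :+ m)) refl y′ M d) ⟩
    falling (y′ + k + suc M) (y′ + d + suc M) ∎
    where
    R = rowHooks (suc (y′ + k)) y′ ys
    G = gaps (suc (y′ + k)) M ys
    rest : suc (y′ + k) + M ∸ (y′ + M) ≡ suc k
    rest = trans (cong (_∸ (y′ + M)) (solve 3 (λ y k m → con 1 :+ (y :+ k) :+ m := (y :+ m) :+ (con 1 :+ k)) refl y′ k M))
                 (ℕP.m+n∸m≡n (y′ + M) (suc k))

  beta : ℕ → List ℕ → ℕ → ℕ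
  beta N l i = part l i + (N ∸ suc i)

  Δℕ : ℕ → (ℕ → ℕ) → ℕ
  Δℕ N v = ∏ℕ-pairs N (λ i j → v i ∸ v j)

  gaps-beta : ∀ x M xs → ∏ℕ M (λ i → (x + M) ∸ beta M xs i) ≡ gaps x M xs
  gaps-beta x M xs = ∏ℕ-cong M (λ i i<M → difference i (part xs i) i<M)
    where
    difference : ∀ i p → i < M → (x + M) ∸ (p + (M ∸ suc i)) ≡ (x + suc i) ∸ p
    difference i p i<M with ℕP.m≤n⇒∃[o]m+o≡n i<M
    ... | r , refl = begin
      (x + (suc i + r)) ∸ (p + (suc i + r ∸ suc i))
        ≡⟨ cong₂ _∸_ (solve 3 (λ x i r → x :+ (con 1 :+ i :+ r) := r :+ (x :+ (con 1 :+ i))) refl x i r)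
                     (trans (cong (p +_) (ℕP.m+n∸m≡n (suc i) r)) (+-comm p r)) ⟩
      (r + (x + suc i)) ∸ (r + p)
        ≡⟨ ℕP.[m+n]∸[m+o]≡n∸o r (x + suc i) p ⟩
      (x + suc i) ∸ p ∎

  frobenius-step : ∀ M x xs → Decreasing (x ∷ xs) → length xs ≤ M →
    H xs * Δℕ M (beta M xs) ≡ ∏ℕ M (λ i → beta M xs i !) →
    H (x ∷ xs) * (∏ℕ M (λ i → (x + M) ∸ beta M xs i) * Δℕ M (beta M xs)) ≡ (x + M) ! * ∏ℕ M (λ i → beta M xs i !)
  frobenius-step M x xs x∷xs↓@(xs₀≤x , xs↓) length≤M ih = begin
    H (x ∷ xs) * (∏ℕ M (λ i → (x + M) ∸ beta M xs i) * Δℕ M (beta M xs))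
      ≡⟨ cong₂ (λ h g → h * (g * Δℕ M (beta M xs))) (H-cons x xs x∷xs↓) (gaps-beta x M xs) ⟩
    rowHooks x x xs * H xs * (gaps x M xs * Δℕ M (beta M xs))
      ≡⟨ solve 4 (λ r h g d → r :* h :* (g :* d) := (r :* g) :* (h :* d)) refl (rowHooks x x xs) (H xs) (gaps x M xs) (Δℕ M (beta M xs)) ⟩
    (rowHooks x x xs * gaps x M xs) * (H xs * Δℕ M (beta M xs))
      ≡⟨ cong₂ _*_ (trans (rowHooks*gaps xs M x x xs↓ xs₀≤x ≤-refl length≤M) (falling-self (x + M))) ih ⟩
    (x + M) ! * ∏ℕ M (λ i → beta M xs i !) ∎

  frobenius : ∀ N l → Decreasing l → length l ≤ N → H l * Δℕ N (beta N l) ≡ ∏ℕ N (λ i → beta N l i !)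
  frobenius zero    []       _ _ = refl
  frobenius (suc M) l l↓ length≤1+M = begin
    H l * Δℕ (suc M) (beta (suc M) l)
      ≡⟨ cong (H l *_) (∏ℕ-pairs-suc M _) ⟩
    H l * (∏ℕ M (λ j → beta (suc M) l 0 ∸ beta (suc M) l (suc j)) * Δℕ M (λ i → beta (suc M) l (suc i)))
      ≡⟨ by-first-row l l↓ length≤1+M ⟩
    beta (suc M) l 0 ! * ∏ℕ M (λ i → beta (suc M) l (suc i) !)
      ≡⟨ ∏ℕ-suc M _ ⟨
    ∏ℕ (suc M) (λ i → beta (suc M) l i !) ∎
    where
    by-first-row : ∀ l → Decreasing l → length l ≤ suc M →
      H l * (∏ℕ M (λ j → beta (suc M) l 0 ∸ beta (suc M) l (suc j)) * Δℕ M (λ i → beta (suc M) l (suc i)))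
        ≡ beta (suc M) l 0 ! * ∏ℕ M (λ i → beta (suc M) l (suc i) !)
    -- H [] and H [ 0 ] both compute to 1: the empty partition is a first row of length 0
    by-first-row []       _              _                = frobenius-step M 0 [] (z≤n , tt) z≤n (frobenius M [] tt z≤n)
    by-first-row (x ∷ xs) x∷xs↓@(_ , xs↓) (s≤s length≤M) = frobenius-step M x xs x∷xs↓ length≤M (frobenius M xs xs↓ length≤M)

open HookFormula

module BetaNumbers where

  open import Data.Nat using (_+_; _∸_)

  beta-strict : ∀ N l → Decreasing l → ∀ {i j} → i < j → j < N → beta N l j < beta N l i
  beta-strict N l l↓ i<j j<N = ℕP.+-mono-≤-< (part-antitone l l↓ (<⇒≤ i<j)) (ℕP.∸-monoʳ-< (s≤s i<j) j<N)

  beta-injective : ∀ N l → Decreasing l → ∀ {i j} → i < N → j < N → beta N l i ≡ beta N l j → i ≡ j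
  beta-injective N l l↓ {i} {j} i<N j<N βᵢ≡βⱼ with ℕP.<-cmp i j
  ... | tri< i<j _   _   = ⊥-elim (<-irrefl (sym βᵢ≡βⱼ) (beta-strict N l l↓ i<j j<N))
  ... | tri≈ _   i≡j _   = i≡j
  ... | tri> _   _   j<i = ⊥-elim (<-irrefl βᵢ≡βⱼ (beta-strict N l l↓ j<i i<N))

  beta-suc : ∀ n l {i} → i < n → beta (suc n) l i ≡ suc (beta n l i)
  beta-suc n l {i} i<n = trans (cong (part l i +_) (ℕP.+-∸-assoc 1 i<n)) (+-suc (part l i) (n ∸ suc i))

  part-beyond : ∀ l i → length l ≤ i → part l i ≡ 0
  part-beyond []      i       _         = refl
  part-beyond (x ∷ l) (suc i) (s≤s l≤i) = part-beyond l i l≤i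

  length≤size : ∀ l → All (0 <_) l → length l ≤ size l
  length≤size []      []          = z≤n
  length≤size (x ∷ l) (0<x ∷ l⁺) = ℕP.+-mono-≤ 0<x (length≤size l l⁺)

  beta-last : ∀ n l → length l ≤ n → beta (suc n) l n ≡ 0
  beta-last n l length≤n = cong₂ _+_ (part-beyond l n length≤n) (ℕP.n∸n≡0 n)

  FitsUnder : Maybe ℕ → List ℕ → Set
  FitsUnder nothing  l = ⊤
  FitsUnder (just y) l = part l 0 ≤ y

  record OneBoxMore (p : Maybe ℕ) (l μ : List ℕ) : Set where
    field
      isDecreasing : Decreasing μ
      fits       : FitsUnder p μ
      size-suc   : size μ ≡ suc (size l)
      length≤    : length μ ≤ suc (length l)

  addBoxesFrom-oneBoxMore : ∀ p l → Decreasing l → All (0 <_) l → FitsUnder p l → FitsUnder p [ 1 ] →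
                            All (OneBoxMore p l) (addBoxesFrom p l)
  addBoxesFrom-oneBoxMore p []       _              _          _        1≤p = record
    { isDecreasing = z≤n , tt ; fits = 1≤p ; size-suc = refl ; length≤ = ≤-refl } ∷ []
  addBoxesFrom-oneBoxMore p (x ∷ xs) x∷xs↓@(xs₀≤x , xs↓) (0<x ∷ xs⁺) fits _ = by-growth p fits
    where
    extend-row : ∀ p → FitsUnder p (x ∷ xs) → ∀ {μ} → OneBoxMore (just x) xs μ → OneBoxMore p (x ∷ xs) (x ∷ μ)
    extend-row p fits μ⁺ = record
      { isDecreasing = OneBoxMore.fits μ⁺ , OneBoxMore.isDecreasing μ⁺
      ; fits       = fits-head p fits
      ; size-suc   = trans (cong (x ℕ.+_) (OneBoxMore.size-suc μ⁺)) (+-suc x (size xs))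
      ; length≤    = s≤s (OneBoxMore.length≤ μ⁺) }
      where
      fits-head : ∀ p → FitsUnder p (x ∷ xs) → ∀ {μ} → FitsUnder p (x ∷ μ)
      fits-head nothing  _   = tt
      fits-head (just y) x≤y = x≤y
    lower-rows : ∀ p → FitsUnder p (x ∷ xs) → All (OneBoxMore p (x ∷ xs)) (map (x ∷_) (addBoxesFrom (just x) xs))
    lower-rows p fits = All.map⁺ (All.map (extend-row p fits) (addBoxesFrom-oneBoxMore (just x) xs xs↓ xs⁺ xs₀≤x 0<x))
    first-row : ∀ p → FitsUnder p (suc x ∷ xs) → OneBoxMore p (x ∷ xs) (suc x ∷ xs)
    first-row p fits = record
      { isDecreasing = ℕP.m≤n⇒m≤1+n xs₀≤x , xs↓ ; fits = fits ; size-suc = refl ; length≤ = ℕP.n≤1+n _ }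
    by-growth : ∀ p → FitsUnder p (x ∷ xs) → All (OneBoxMore p (x ∷ xs)) (addBoxesFrom p (x ∷ xs))
    by-growth nothing  fits = first-row nothing tt ∷ lower-rows nothing fits
    by-growth (just y) fits with x <ᵇ y in x<ᵇy
    ... | true  = first-row (just y) (ℕP.<ᵇ⇒< x y (Equivalence.from T-≡ x<ᵇy)) ∷ lower-rows (just y) fits
    ... | false = lower-rows (just y) fits

  raise : ℕ → (ℕ → ℕ) → ℕ → ℕ
  raise k v i with i ≟ k
  ... | yes _ = suc (v i)
  ... | no  _ = v i

  raise-self : ∀ k v → raise k v k ≡ suc (v k)
  raise-self k v with k ≟ k
  ... | yes _   = refl
  ... | no  k≢k = ⊥-elim (k≢k refl)

  raise-≢ : ∀ {k i} v → i ≢ k → raise k v i ≡ v i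
  raise-≢ {k} {i} v i≢k with i ≟ k
  ... | yes i≡k = ⊥-elim (i≢k i≡k)
  ... | no  _   = refl

  infixr 5 _◂_
  _◂_ : ℕ → (ℕ → ℕ) → ℕ → ℕ
  (a ◂ v) zero    = a
  (a ◂ v) (suc i) = v i

  raise-suc : ∀ k v i → raise (suc k) v (suc i) ≡ raise k (v ∘ suc) i
  raise-suc k v i = by-cases (i ≟ k)
    where
    by-cases : Dec (i ≡ k) → raise (suc k) v (suc i) ≡ raise k (v ∘ suc) i
    by-cases (yes refl) = trans (raise-self (suc i) v) (sym (raise-self i (v ∘ suc)))
    by-cases (no  i≢k)  = trans (raise-≢ v (i≢k ∘ ℕP.suc-injective)) (sym (raise-≢ (v ∘ suc) i≢k))

open BetaNumbers

open import Data.Rational using (_+_; _*_; _-_; -_)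
open ℚSolver.+-*-Solver
open ≡-Reasoning

open RangeFold ℚP.+-0-isCommutativeMonoid using ()
  renaming (fold to ∑; fold-cong to ∑-cong; fold-suc to ∑-suc; fold-distrib to ∑-distrib; fold-ε to ∑-zero)
open RangeFold ℚP.*-1-isCommutativeMonoid using (except; except-self; except-≢)
  renaming ( fold to ∏; fold-cong to ∏-cong
           ; fold-except-cong to ∏-except-cong; fold-except-suc to ∏-except-suc
           ; fold-except-last to ∏-except-last; fold-split-at to ∏-split-at
           ; fold-pairs to ∏-pairs; fold-map-applyUpTo to prodℚ-map-applyUpTo)

∑-*ˡ : ∀ n c (f : ℕ → ℚ) → c * ∑ n f ≡ ∑ n (λ i → c * f i)
∑-*ˡ zero    c f = ℚP.*-zeroʳ c
∑-*ˡ (suc n) c f = trans (ℚP.*-distribˡ-+ c (∑ n f) (f n)) (cong (_+ c * f n) (∑-*ˡ n c f))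

∑-*ʳ : ∀ n c (f : ℕ → ℚ) → ∑ n f * c ≡ ∑ n (λ i → f i * c)
∑-*ʳ n c f = trans (ℚP.*-comm (∑ n f) c) (trans (∑-*ˡ n c f) (∑-cong n (λ i _ → ℚP.*-comm c (f i))))

-- a total inverse, with the junk value inv 0ℚ = 0ℚ
inv : ℚ → ℚ
inv p with p ℚP.≟ 0ℚ
... | yes _   = 0ℚ
... | no  p≢0 = ℚ.1/_ p {{ℚ.≢-nonZero p≢0}}

*-inv : ∀ p → p ≢ 0ℚ → p * inv p ≡ 1ℚ
*-inv p p≢0 with p ℚP.≟ 0ℚ
... | yes p≡0 = ⊥-elim (p≢0 p≡0)
... | no  p≢0 = ℚP.*-inverseʳ p {{ℚ.≢-nonZero p≢0}}

inv-unique : ∀ p q → p * q ≡ 1ℚ → inv p ≡ q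
inv-unique p q pq≡1 = begin
  inv p             ≡⟨ ℚP.*-identityʳ (inv p) ⟨
  inv p * 1ℚ        ≡⟨ cong (inv p *_) pq≡1 ⟨
  inv p * (p * q)   ≡⟨ solve 3 (λ x y z → x :* (y :* z) := (y :* x) :* z) refl (inv p) p q ⟩
  (p * inv p) * q   ≡⟨ cong (_* q) (*-inv p p≢0) ⟩
  1ℚ * q            ≡⟨ ℚP.*-identityˡ q ⟩
  q                 ∎
  where
  p≢0 : p ≢ 0ℚ
  p≢0 p≡0 = ℚP.1≢0 (trans (sym pq≡1) (trans (cong (_* q) p≡0) (ℚP.*-zeroˡ q)))

*-≢0 : ∀ {p q} → p ≢ 0ℚ → q ≢ 0ℚ → p * q ≢ 0ℚ
*-≢0 {p} {q} p≢0 q≢0 pq≡0 = ℚP.1≢0 (begin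
  1ℚ                           ≡⟨ cong₂ _*_ (*-inv p p≢0) (*-inv q q≢0) ⟨
  (p * inv p) * (q * inv q)    ≡⟨ solve 4 (λ p p′ q q′ → (p :* p′) :* (q :* q′) := (p :* q) :* (p′ :* q′)) refl p (inv p) q (inv q) ⟩
  (p * q) * (inv p * inv q)    ≡⟨ cong (_* (inv p * inv q)) pq≡0 ⟩
  0ℚ * (inv p * inv q)         ≡⟨ ℚP.*-zeroˡ (inv p * inv q) ⟩
  0ℚ                           ∎)

inv-* : ∀ p q → p ≢ 0ℚ → q ≢ 0ℚ → inv (p * q) ≡ inv p * inv q
inv-* p q p≢0 q≢0 = inv-unique (p * q) (inv p * inv q) (begin
  (p * q) * (inv p * inv q)    ≡⟨ solve 4 (λ p p′ q q′ → (p :* q) :* (p′ :* q′) := (p :* p′) :* (q :* q′)) refl p (inv p) q (inv q) ⟩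
  (p * inv p) * (q * inv q)    ≡⟨ cong₂ _*_ (*-inv p p≢0) (*-inv q q≢0) ⟩
  1ℚ                           ∎)

∏-≢0 : ∀ n {f : ℕ → ℚ} → (∀ i → i < n → f i ≢ 0ℚ) → ∏ n f ≢ 0ℚ
∏-≢0 zero    f≢0 = ℚP.1≢0
∏-≢0 (suc n) f≢0 = *-≢0 (∏-≢0 n (λ i i<n → f≢0 i (m<n⇒m<1+n i<n))) (f≢0 n ≤-refl)

∏-except-≢0 : ∀ k n {f : ℕ → ℚ} → (∀ i → i < n → i ≢ k → f i ≢ 0ℚ) → ∏ n (except k f) ≢ 0ℚ
∏-except-≢0 k n {f} f≢0 = ∏-≢0 n (λ i i<n → by-cases i i<n (i ≟ k))
  where
  by-cases : ∀ i → i < n → Dec (i ≡ k) → except k f i ≢ 0ℚ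
  by-cases i i<n (yes refl) = subst (_≢ 0ℚ) (sym (except-self k f)) ℚP.1≢0
  by-cases i i<n (no  i≢k)  = subst (_≢ 0ℚ) (sym (except-≢ f i≢k)) (f≢0 i i<n i≢k)

linear-interpolation : ∀ u α β γ w → (β - α) * w ≡ 1ℚ →
                       u + γ ≡ (- α + γ) * w * (u + β) + (β - γ) * w * (u + α)
linear-interpolation u α β γ w [β-α]w≡1 = begin
  u + γ                      ≡⟨ ℚP.*-identityʳ (u + γ) ⟨
  (u + γ) * 1ℚ               ≡⟨ cong ((u + γ) *_) [β-α]w≡1 ⟨
  (u + γ) * ((β - α) * w)    ≡⟨ solve 5 (λ u α β γ w → (u :+ γ) :* ((β :- α) :* w)
                                         := (:- α :+ γ) :* w :* (u :+ β) :+ (β :- γ) :* w :* (u :+ α))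
                                       refl u α β γ w ⟩
  (- α + γ) * w * (u + β) + (β - γ) * w * (u + α) ∎

module LagrangeInterpolation (b c : ℕ → ℚ) where

  Q : ℕ → ℚ → ℚ
  Q N u = ∏ N (λ i → u + c i)

  basis : ℕ → ℕ → ℚ → ℚ
  basis N k u = ∏ (suc N) (except k (λ i → u + b i))

  denominator : ℕ → ℕ → ℚ
  denominator N k = ∏ (suc N) (except k (λ i → b i - b k))

  weight : ℕ → ℕ → ℚ
  weight N k = Q N (- b k) * inv (denominator N k)

  DistinctNodes : ℕ → Set
  DistinctNodes M = ∀ i j → i < M → j < M → i ≢ j → b i - b j ≢ 0ℚ

  Interpolates : ℕ → Set
  Interpolates N = (∀ u → Q N u ≡ ∑ (suc N) (λ k → weight N k * basis N k u))
                 × ∑ (suc N) (weight N) ≡ 1ℚ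

  denominator-≢0 : ∀ N k → DistinctNodes (suc N) → k < suc N → denominator N k ≢ 0ℚ
  denominator-≢0 N k distinct k≤N = ∏-except-≢0 k (suc N) (λ i i≤N i≢k → distinct i k i≤N k≤N i≢k)

  distinct-pred : ∀ {M} → DistinctNodes (suc M) → DistinctNodes M
  distinct-pred distinct i j i<M j<M = distinct i j (m<n⇒m<1+n i<M) (m<n⇒m<1+n j<M)

  -- The new factor u + γ is split linearly between the new node −β and each old node −b k.
  module Step (N : ℕ) (distinct : DistinctNodes (suc (suc N))) (ih : Interpolates N) where

    β γ : ℚ
    β = b (suc N)
    γ = c N

    w : ℕ → ℚ
    w k = inv (β - b k)

    S : ℚ
    S = ∑ (suc N) (λ k → weight N k * w k)

    P : ℚ → ℚ
    P u = ∏ (suc N) (λ i → u + b i)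

    new≢old : ∀ {k} → k < suc N → suc N ≢ k
    new≢old k≤N 1+N≡k = <-irrefl (sym 1+N≡k) k≤N

    β-b≢0 : ∀ {k} → k < suc N → β - b k ≢ 0ℚ
    β-b≢0 k≤N = distinct (suc N) _ ≤-refl (m<n⇒m<1+n k≤N) (new≢old k≤N)

    w-inverse : ∀ {k} → k < suc N → (β - b k) * w k ≡ 1ℚ
    w-inverse k≤N = *-inv _ (β-b≢0 k≤N)

    basis-old : ∀ {k} → k < suc N → ∀ u → basis (suc N) k u ≡ basis N k u * (u + β)
    basis-old k≤N u = ∏-except-suc (suc N) _ (new≢old k≤N)

    basis-new : ∀ u → basis (suc N) (suc N) u ≡ P u
    basis-new u = ∏-except-last (suc N) _

    P-split : ∀ {k} → k < suc N → ∀ u → P u ≡ basis N k u * (u + b k)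
    P-split k≤N u = ∏-split-at (suc N) _ k≤N

    weight-old : ∀ {k} → k < suc N → weight (suc N) k ≡ weight N k * (- b k + γ) * w k
    weight-old {k} k≤N = begin
      Q N (- b k) * (- b k + γ) * inv (denominator (suc N) k)
        ≡⟨ cong (λ d → Q N (- b k) * (- b k + γ) * inv d) (∏-except-suc (suc N) _ (new≢old k≤N)) ⟩
      Q N (- b k) * (- b k + γ) * inv (denominator N k * (β - b k))
        ≡⟨ cong (Q N (- b k) * (- b k + γ) *_)
                (inv-* _ _ (denominator-≢0 N k (distinct-pred distinct) k≤N) (β-b≢0 k≤N)) ⟩
      Q N (- b k) * (- b k + γ) * (inv (denominator N k) * w k)
        ≡⟨ solve 4 (λ q x y z → q :* x :* (y :* z) := q :* y :* x :* z) refl (Q N (- b k)) (- b k + γ) (inv (denominator N k)) (w k) ⟩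
      weight N k * (- b k + γ) * w k ∎

    weight-old-split : ∀ {k} → k < suc N → weight (suc N) k ≡ weight N k + (- β + γ) * (weight N k * w k)
    weight-old-split {k} k≤N = begin
      weight (suc N) k
        ≡⟨ weight-old k≤N ⟩
      V * (- b k + γ) * w k
        ≡⟨ solve 5 (λ v α γ w β → v :* (:- α :+ γ) :* w := v :* ((β :- α) :* w) :+ (:- β :+ γ) :* (v :* w))
                 refl V (b k) γ (w k) β ⟩
      V * ((β - b k) * w k) + (- β + γ) * (V * w k)
        ≡⟨ cong (λ x → V * x + (- β + γ) * (V * w k)) (w-inverse k≤N) ⟩
      V * 1ℚ + (- β + γ) * (V * w k)
        ≡⟨ cong (_+ (- β + γ) * (V * w k)) (ℚP.*-identityʳ V) ⟩
      V + (- β + γ) * (V * w k) ∎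
      where V = weight N k

    basis-at-new : ∀ {k} → k < suc N → basis N k (- β) ≡ - ∏ (suc N) (λ i → b i - β) * w k
    basis-at-new {k} k≤N = begin
      t₀                          ≡⟨ ℚP.*-identityʳ t₀ ⟨
      t₀ * 1ℚ                     ≡⟨ cong (t₀ *_) (w-inverse k≤N) ⟨
      t₀ * ((β - b k) * w k)      ≡⟨ solve 4 (λ t β α w → t :* ((β :- α) :* w) := :- (t :* (α :- β)) :* w) refl t₀ β (b k) (w k) ⟩
      - (t₀ * (b k - β)) * w k    ≡⟨ cong (λ x → - x * w k) split ⟨
      - ∏ (suc N) (λ i → b i - β) * w k ∎
      where
      t₀ = basis N k (- β)
      split : ∏ (suc N) (λ i → b i - β) ≡ t₀ * (b k - β)
      split = trans (∏-split-at (suc N) _ k≤N)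
                    (cong (_* (b k - β)) (∏-except-cong k (suc N) (λ i _ _ → ℚP.+-comm (b i) (- β))))

    Q-at-new : Q N (- β) ≡ - ∏ (suc N) (λ i → b i - β) * S
    Q-at-new = begin
      Q N (- β)                                        ≡⟨ proj₁ ih (- β) ⟩
      ∑ (suc N) (λ k → weight N k * basis N k (- β))   ≡⟨ ∑-cong (suc N) (λ k k≤N → cong (weight N k *_) (basis-at-new k≤N)) ⟩
      ∑ (suc N) (λ k → weight N k * (- B * w k))
        ≡⟨ ∑-cong (suc N) (λ k _ → solve 3 (λ v p w → v :* (:- p :* w) := :- p :* (v :* w)) refl (weight N k) B (w k)) ⟩
      ∑ (suc N) (λ k → - B * (weight N k * w k))       ≡⟨ ∑-*ˡ (suc N) (- B) _ ⟨
      - B * S                                          ∎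
      where B = ∏ (suc N) (λ i → b i - β)

    weight-new : weight (suc N) (suc N) ≡ - S * (- β + γ)
    weight-new = begin
      Q N (- β) * (- β + γ) * inv (denominator (suc N) (suc N))
        ≡⟨ cong₂ (λ q d → q * (- β + γ) * inv d) Q-at-new (∏-except-last (suc N) _) ⟩
      - B * S * (- β + γ) * inv B
        ≡⟨ solve 4 (λ p s x p′ → :- p :* s :* x :* p′ := :- s :* x :* (p :* p′)) refl B S (- β + γ) (inv B) ⟩
      - S * (- β + γ) * (B * inv B)
        ≡⟨ cong (- S * (- β + γ) *_) (*-inv B B≢0) ⟩
      - S * (- β + γ) * 1ℚ
        ≡⟨ ℚP.*-identityʳ _ ⟩
      - S * (- β + γ) ∎
      where
      B = ∏ (suc N) (λ i → b i - β)
      B≢0 : B ≢ 0ℚ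
      B≢0 = ∏-≢0 (suc N) (λ i i≤N → distinct i (suc N) (m<n⇒m<1+n i≤N) ≤-refl (new≢old i≤N ∘ sym))

    term-split : ∀ {k} → k < suc N → ∀ u →
      weight N k * basis N k u * (u + γ) ≡ weight (suc N) k * basis (suc N) k u + (β - γ) * P u * (weight N k * w k)
    term-split {k} k≤N u = begin
      V * t * (u + γ)
        ≡⟨ cong (V * t *_) (linear-interpolation u (b k) β γ (w k) (w-inverse k≤N)) ⟩
      V * t * ((- b k + γ) * w k * (u + β) + (β - γ) * w k * (u + b k))
        ≡⟨ solve 7 (λ v t α β γ w u → v :* t :* ((:- α :+ γ) :* w :* (u :+ β) :+ (β :- γ) :* w :* (u :+ α))
                                     := (v :* (:- α :+ γ) :* w) :* (t :* (u :+ β)) :+ (β :- γ) :* (t :* (u :+ α)) :* (v :* w))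
                 refl V t (b k) β γ (w k) u ⟩
      (V * (- b k + γ) * w k) * (t * (u + β)) + (β - γ) * (t * (u + b k)) * (V * w k)
        ≡⟨ cong₂ (λ x y → x + (β - γ) * y * (V * w k))
                 (sym (cong₂ _*_ (weight-old k≤N) (basis-old k≤N u))) (sym (P-split k≤N u)) ⟩
      weight (suc N) k * basis (suc N) k u + (β - γ) * P u * (V * w k) ∎
      where
      V = weight N k
      t = basis N k u

    interpolates : Interpolates (suc N)
    interpolates = expansion , weights-sum
      where
      old : ℚ → ℚ
      old u = ∑ (suc N) (λ k → weight (suc N) k * basis (suc N) k u)

      expansion : ∀ u → Q (suc N) u ≡ ∑ (suc (suc N)) (λ k → weight (suc N) k * basis (suc N) k u)
      expansion u = begin
        Q N u * (u + γ)
          ≡⟨ cong (_* (u + γ)) (proj₁ ih u) ⟩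
        ∑ (suc N) (λ k → weight N k * basis N k u) * (u + γ)
          ≡⟨ ∑-*ʳ (suc N) (u + γ) _ ⟩
        ∑ (suc N) (λ k → weight N k * basis N k u * (u + γ))
          ≡⟨ ∑-cong (suc N) (λ k k≤N → term-split k≤N u) ⟩
        ∑ (suc N) (λ k → weight (suc N) k * basis (suc N) k u + (β - γ) * P u * (weight N k * w k))
          ≡⟨ ∑-distrib (suc N) _ _ ⟩
        old u + ∑ (suc N) (λ k → (β - γ) * P u * (weight N k * w k))
          ≡⟨ cong (old u +_) (∑-*ˡ (suc N) ((β - γ) * P u) _) ⟨
        old u + (β - γ) * P u * S
          ≡⟨ cong (old u +_) (solve 4 (λ β γ p s → (β :- γ) :* p :* s := :- s :* (:- β :+ γ) :* p) refl β γ (P u) S) ⟩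
        old u + - S * (- β + γ) * P u
          ≡⟨ cong (old u +_) (cong₂ _*_ weight-new (basis-new u)) ⟨
        old u + weight (suc N) (suc N) * basis (suc N) (suc N) u ∎

      weights-sum : ∑ (suc (suc N)) (weight (suc N)) ≡ 1ℚ
      weights-sum = begin
        ∑ (suc N) (weight (suc N)) + weight (suc N) (suc N)
          ≡⟨ cong₂ _+_ (∑-cong (suc N) (λ k k≤N → weight-old-split k≤N)) weight-new ⟩
        ∑ (suc N) (λ k → weight N k + (- β + γ) * (weight N k * w k)) + - S * (- β + γ)
          ≡⟨ cong (_+ - S * (- β + γ)) (∑-distrib (suc N) _ _) ⟩
        (∑ (suc N) (weight N) + ∑ (suc N) (λ k → (- β + γ) * (weight N k * w k))) + - S * (- β + γ)
          ≡⟨ cong (λ x → (x + ∑ (suc N) (λ k → (- β + γ) * (weight N k * w k))) + - S * (- β + γ)) (proj₂ ih) ⟩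
        (1ℚ + ∑ (suc N) (λ k → (- β + γ) * (weight N k * w k))) + - S * (- β + γ)
          ≡⟨ cong (λ x → (1ℚ + x) + - S * (- β + γ)) (∑-*ˡ (suc N) (- β + γ) _) ⟨
        (1ℚ + (- β + γ) * S) + - S * (- β + γ)
          ≡⟨ solve 2 (λ x s → (con 1ℚ :+ x :* s) :+ :- s :* x := con 1ℚ) refl (- β + γ) S ⟩
        1ℚ ∎

  interpolation : ∀ N → DistinctNodes (suc N) → Interpolates N
  interpolation zero    _        = (λ u → refl) , refl
  interpolation (suc N) distinct = Step.interpolates N distinct (interpolation N (distinct-pred distinct))

Δ : ℕ → (ℕ → ℚ) → ℚ
Δ N v = ∏-pairs N (λ i j → v i - v j)

Δ-cong : ∀ N {v w : ℕ → ℚ} → (∀ i → i < N → v i ≡ w i) → Δ N v ≡ Δ N w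
Δ-cong N v≗w = ∏-cong N (λ j j<N → ∏-cong j (λ i i<j →
  cong₂ _-_ (v≗w i (ℕP.<-trans i<j j<N)) (v≗w j j<N)))

Δ-change-one : ∀ N k (v w : ℕ → ℚ) → k < N → (∀ i → i ≢ k → w i ≡ v i) →
  Δ N w * ∏ N (except k (λ i → v i - v k)) ≡ Δ N v * ∏ N (except k (λ i → v i - w k))
Δ-change-one (suc N) k v w k≤N w≗v with k ≟ N
... | yes refl = begin
  Δ k w * ∏ k (λ i → w i - w k) * ∏ (suc k) (except k (λ i → v i - v k))
    ≡⟨ cong₂ (λ x y → x * y * ∏ (suc k) (except k (λ i → v i - v k)))
             (Δ-cong k (λ i i<k → w≗v i (λ i≡k → <-irrefl i≡k i<k)))
             (∏-cong k (λ i i<k → cong (_- w k) (w≗v i (λ i≡k → <-irrefl i≡k i<k)))) ⟩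
  Δ k v * ∏ k (λ i → v i - w k) * ∏ (suc k) (except k (λ i → v i - v k))
    ≡⟨ cong (Δ k v * ∏ k (λ i → v i - w k) *_) (∏-except-last k _) ⟩
  Δ k v * ∏ k (λ i → v i - w k) * ∏ k (λ i → v i - v k)
    ≡⟨ solve 3 (λ a b c → a :* b :* c := a :* c :* b) refl (Δ k v) (∏ k (λ i → v i - w k)) (∏ k (λ i → v i - v k)) ⟩
  Δ k v * ∏ k (λ i → v i - v k) * ∏ k (λ i → v i - w k)
    ≡⟨ cong (Δ k v * ∏ k (λ i → v i - v k) *_) (∏-except-last k _) ⟨
  Δ k v * ∏ k (λ i → v i - v k) * ∏ (suc k) (except k (λ i → v i - w k)) ∎
... | no k≢N = begin
  Δ N w * ∏ N (λ i → w i - w N) * ∏ (suc N) (except k (λ i → v i - v k))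
    ≡⟨ cong₂ (λ x y → Δ N w * x * y) (∏-split-at N _ k<N) (∏-except-suc N _ N≢k) ⟩
  Δ N w * (∏ N (except k (λ i → w i - w N)) * (w k - w N)) * (A * (v N - v k))
    ≡⟨ cong (λ x → Δ N w * (x * (w k - w N)) * (A * (v N - v k)))
            (∏-except-cong k N (λ i _ i≢k → cong₂ _-_ (w≗v i i≢k) wN≡vN)) ⟩
  Δ N w * (X * (w k - w N)) * (A * (v N - v k))
    ≡⟨ solve 5 (λ d x p a q → d :* (x :* p) :* (a :* q) := (d :* a) :* (x :* p :* q)) refl (Δ N w) X (w k - w N) A (v N - v k) ⟩
  (Δ N w * A) * (X * (w k - w N) * (v N - v k))
    ≡⟨ cong₂ _*_ (Δ-change-one N k v w k<N w≗v) (cong (λ y → X * (w k - y) * (v N - v k)) wN≡vN) ⟩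
  (Δ N v * B) * (X * (w k - v N) * (v N - v k))
    ≡⟨ solve 6 (λ d b x wk vN vk → (d :* b) :* (x :* (wk :- vN) :* (vN :- vk)) := d :* (x :* (vk :- vN)) :* (b :* (vN :- wk)))
               refl (Δ N v) B X (w k) (v N) (v k) ⟩
  Δ N v * (X * (v k - v N)) * (B * (v N - w k))
    ≡⟨ cong₂ (λ x y → Δ N v * x * y) (∏-split-at N _ k<N) (∏-except-suc N _ N≢k) ⟨
  Δ N v * ∏ N (λ i → v i - v N) * ∏ (suc N) (except k (λ i → v i - w k)) ∎
  where
  k<N : k < N
  k<N = ≤∧≢⇒< (≤-pred k≤N) k≢N
  N≢k : N ≢ k
  N≢k = k≢N ∘ sym
  wN≡vN : w N ≡ v N
  wN≡vN = w≗v N N≢k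
  X = ∏ N (except k (λ i → v i - v N))
  A = ∏ N (except k (λ i → v i - v k))
  B = ∏ N (except k (λ i → v i - w k))

∏-zero : ∀ n {f : ℕ → ℚ} {i} → i < n → f i ≡ 0ℚ → ∏ n f ≡ 0ℚ
∏-zero n {f} {i} i<n fᵢ≡0 = trans (∏-split-at n f i<n) (trans (cong (∏ n (except i f) *_) fᵢ≡0) (ℚP.*-zeroʳ (∏ n (except i f))))

Δ-tie : ∀ N v {i} → suc i < N → v i ≡ v (suc i) → Δ N v ≡ 0ℚ
Δ-tie (suc N) v {i} (s≤s 1+i≤N) tie with suc i ≟ N
... | yes refl = trans (cong (Δ (suc i) v *_) (∏-zero (suc i) ≤-refl (trans (cong (_- v (suc i)) tie) (ℚP.+-inverseʳ (v (suc i))))))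
                       (ℚP.*-zeroʳ (Δ (suc i) v))
... | no  1+i≢N = trans (cong (_* ∏ N (λ j → v j - v N)) (Δ-tie N v (≤∧≢⇒< 1+i≤N 1+i≢N) tie)) (ℚP.*-zeroˡ (∏ N (λ j → v j - v N)))

module Raising (b : ℕ → ℚ) (n : ℕ) (W : ℕ → ℕ → ℚ)
               (W-self : ∀ k → W k k ≡ b k + 1ℚ) (W-other : ∀ k i → i ≢ k → W k i ≡ b i)
               (b-last : b n ≡ 0ℚ)
               (distinct : ∀ i j → i < suc n → j < suc n → i ≢ j → b i - b j ≢ 0ℚ)
               (b+1≢0 : ∀ k → k < suc n → b k + 1ℚ ≢ 0ℚ) where

  open LagrangeInterpolation b (λ i → b i - 1ℚ)

  b-W-self : ∀ k i → b i - W k k ≡ - b k + (b i - 1ℚ)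
  b-W-self k i = trans (cong (λ x → b i - x) (W-self k))
                       (solve 2 (λ x y → x :- (y :+ con 1ℚ) := :- y :+ (x :- con 1ℚ)) refl (b i) (b k))

  -- The factor i = n on the left is −(b k + 1); the factor i = k of Q n (− b k) is −1.
  ∏-except-raised : ∀ k → k < suc n → ∏ (suc n) (except k (λ i → b i - W k k)) ≡ (b k + 1ℚ) * Q n (- b k)
  ∏-except-raised k k≤n with k ≟ n
  ... | yes refl = begin
    ∏ (suc k) (except k (λ i → b i - W k k)) ≡⟨ ∏-except-last k _ ⟩
    ∏ k (λ i → b i - W k k)                  ≡⟨ ∏-cong k (λ i _ → b-W-self k i) ⟩
    Q k (- b k)                              ≡⟨ ℚP.*-identityˡ _ ⟨
    1ℚ * Q k (- b k)                         ≡⟨ cong (λ x → (x + 1ℚ) * Q k (- b k)) b-last ⟨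
    (b k + 1ℚ) * Q k (- b k)                 ∎
  ... | no k≢n = begin
    ∏ (suc n) (except k (λ i → b i - W k k))   ≡⟨ ∏-except-suc n _ (k≢n ∘ sym) ⟩
    ∏ n (except k (λ i → b i - W k k)) * (b n - W k k)
      ≡⟨ cong₂ (λ x y → x * (y - W k k)) (∏-except-cong k n (λ i _ _ → b-W-self k i)) b-last ⟩
    Y * (0ℚ - W k k)                           ≡⟨ cong (λ x → Y * (0ℚ - x)) (W-self k) ⟩
    Y * (0ℚ - (b k + 1ℚ))                      ≡⟨ solve 2 (λ y x → y :* (con 0ℚ :- (x :+ con 1ℚ))
                                                         := (x :+ con 1ℚ) :* (y :* (:- x :+ (x :- con 1ℚ)))) refl Y (b k) ⟩
    (b k + 1ℚ) * (Y * (- b k + (b k - 1ℚ)))    ≡⟨ cong ((b k + 1ℚ) *_) (∏-split-at n _ (≤∧≢⇒< (≤-pred k≤n) k≢n)) ⟨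
    (b k + 1ℚ) * Q n (- b k)                   ∎
    where Y = ∏ n (except k (λ i → - b k + (b i - 1ℚ)))

  Δ-raised : ∀ k → k < suc n → Δ (suc n) (W k) * inv (b k + 1ℚ) ≡ Δ (suc n) b * weight n k
  Δ-raised k k≤n = begin
    ΔW * inv (b k + 1ℚ)
      ≡⟨ ℚP.*-identityʳ _ ⟨
    ΔW * inv (b k + 1ℚ) * 1ℚ
      ≡⟨ cong (ΔW * inv (b k + 1ℚ) *_) (*-inv _ (denominator-≢0 n k distinct k≤n)) ⟨
    ΔW * inv (b k + 1ℚ) * (denominator n k * inv (denominator n k))
      ≡⟨ solve 4 (λ a i d d′ → a :* i :* (d :* d′) := (a :* d) :* i :* d′)
               refl ΔW (inv (b k + 1ℚ)) (denominator n k) (inv (denominator n k)) ⟩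
    (ΔW * denominator n k) * inv (b k + 1ℚ) * inv (denominator n k)
      ≡⟨ cong (λ x → x * inv (b k + 1ℚ) * inv (denominator n k)) (Δ-change-one (suc n) k b (W k) k≤n (W-other k)) ⟩
    (Δ (suc n) b * ∏ (suc n) (except k (λ i → b i - W k k))) * inv (b k + 1ℚ) * inv (denominator n k)
      ≡⟨ cong (λ x → (Δ (suc n) b * x) * inv (b k + 1ℚ) * inv (denominator n k)) (∏-except-raised k k≤n) ⟩
    (Δ (suc n) b * ((b k + 1ℚ) * Q n (- b k))) * inv (b k + 1ℚ) * inv (denominator n k)
      ≡⟨ solve 5 (λ d p q p′ d′ → (d :* (p :* q)) :* p′ :* d′ := d :* (q :* d′) :* (p :* p′))
               refl (Δ (suc n) b) (b k + 1ℚ) (Q n (- b k)) (inv (b k + 1ℚ)) (inv (denominator n k)) ⟩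
    Δ (suc n) b * weight n k * ((b k + 1ℚ) * inv (b k + 1ℚ))
      ≡⟨ cong (Δ (suc n) b * weight n k *_) (*-inv _ (b+1≢0 k k≤n)) ⟩
    Δ (suc n) b * weight n k * 1ℚ
      ≡⟨ ℚP.*-identityʳ _ ⟩
    Δ (suc n) b * weight n k ∎
    where ΔW = Δ (suc n) (W k)

  ∏-raised : ∀ z k → k < suc n → ∏ (suc n) (λ i → z + W k i) ≡ ∏ (suc n) (λ i → z + b i) + basis n k z
  ∏-raised z k k≤n = begin
    ∏ (suc n) (λ i → z + W k i)
      ≡⟨ ∏-split-at (suc n) _ k≤n ⟩
    ∏ (suc n) (except k (λ i → z + W k i)) * (z + W k k)
      ≡⟨ cong₂ (λ x y → x * (z + y)) (∏-except-cong k (suc n) (λ i _ i≢k → cong (z +_) (W-other k i i≢k))) (W-self k) ⟩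
    basis n k z * (z + (b k + 1ℚ))
      ≡⟨ solve 3 (λ t z x → t :* (z :+ (x :+ con 1ℚ)) := t :* (z :+ x) :+ t) refl (basis n k z) z (b k) ⟩
    basis n k z * (z + b k) + basis n k z
      ≡⟨ cong (_+ basis n k z) (∏-split-at (suc n) _ k≤n) ⟨
    ∏ (suc n) (λ i → z + b i) + basis n k z ∎

  ∑-raised : ∀ z →
    ∑ (suc n) (λ k → Δ (suc n) (W k) * ∏ (suc n) (λ i → z + W k i) * inv (b k + 1ℚ))
      ≡ Δ (suc n) b * (∏ (suc n) (λ i → z + b i) + Q n z)
  ∑-raised z = begin
    ∑ (suc n) (λ k → Δ (suc n) (W k) * ∏ (suc n) (λ i → z + W k i) * inv (b k + 1ℚ))
      ≡⟨ ∑-cong (suc n) term ⟩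
    ∑ (suc n) (λ k → Δ (suc n) b * (weight n k * P + weight n k * basis n k z))
      ≡⟨ ∑-*ˡ (suc n) (Δ (suc n) b) _ ⟨
    Δ (suc n) b * ∑ (suc n) (λ k → weight n k * P + weight n k * basis n k z)
      ≡⟨ cong (Δ (suc n) b *_) (∑-distrib (suc n) _ _) ⟩
    Δ (suc n) b * (∑ (suc n) (λ k → weight n k * P) + ∑ (suc n) (λ k → weight n k * basis n k z))
      ≡⟨ cong₂ (λ x y → Δ (suc n) b * (x + y)) (trans (sym (∑-*ʳ (suc n) P (weight n))) (cong (_* P) weights-sum))
                                               (sym (expansion z)) ⟩
    Δ (suc n) b * (1ℚ * P + Q n z)
      ≡⟨ cong (λ x → Δ (suc n) b * (x + Q n z)) (ℚP.*-identityˡ P) ⟩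
    Δ (suc n) b * (P + Q n z) ∎
    where
    P = ∏ (suc n) (λ i → z + b i)
    expansion = proj₁ (interpolation n distinct)
    weights-sum = proj₂ (interpolation n distinct)
    term : ∀ k → k < suc n → Δ (suc n) (W k) * ∏ (suc n) (λ i → z + W k i) * inv (b k + 1ℚ)
                             ≡ Δ (suc n) b * (weight n k * P + weight n k * basis n k z)
    term k k≤n = begin
      Δ (suc n) (W k) * ∏ (suc n) (λ i → z + W k i) * inv (b k + 1ℚ)
        ≡⟨ solve 3 (λ a p i → a :* p :* i := (a :* i) :* p) refl (Δ (suc n) (W k)) (∏ (suc n) (λ i → z + W k i)) (inv (b k + 1ℚ)) ⟩
      (Δ (suc n) (W k) * inv (b k + 1ℚ)) * ∏ (suc n) (λ i → z + W k i)
        ≡⟨ cong₂ _*_ (Δ-raised k k≤n) (∏-raised z k k≤n) ⟩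
      Δ (suc n) b * weight n k * (P + basis n k z)
        ≡⟨ solve 4 (λ d v p t → d :* v :* (p :+ t) := d :* (v :* p :+ v :* t)) refl (Δ (suc n) b) (weight n k) P (basis n k z) ⟩
      Δ (suc n) b * (weight n k * P + weight n k * basis n k z) ∎

ι : ℕ → ℚ
ι n = ℤtoℚ (ℤ.+ n)

ι≡mkℚ : ∀ n → ι n ≡ ℚ.mkℚ (ℤ.+ n) 0 (Coprimality.sym (Coprimality.1-coprimeTo n))
ι≡mkℚ n = ℚP.normalize-coprime (Coprimality.sym (Coprimality.1-coprimeTo n))

ι-+ : ∀ m n → ι (m ℕ.+ n) ≡ ι m + ι n
ι-+ m n = sym (trans (cong₂ _+_ (ι≡mkℚ m) (ι≡mkℚ n)) (ℚP./-cong numerator refl))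
  where
  numerator : ℤ.+ m ℤ.* ℤ.+ 1 ℤ.+ ℤ.+ n ℤ.* ℤ.+ 1 ≡ ℤ.+ (m ℕ.+ n)
  numerator = trans (cong₂ ℤ._+_ (ℤP.*-identityʳ (ℤ.+ m)) (ℤP.*-identityʳ (ℤ.+ n))) (sym (ℤP.pos-+ m n))

ι-* : ∀ m n → ι (m ℕ.* n) ≡ ι m * ι n
ι-* m n = sym (trans (cong₂ _*_ (ι≡mkℚ m) (ι≡mkℚ n)) (ℚP./-cong (sym (ℤP.pos-* m n)) refl))

ι-suc : ∀ n → ι (suc n) ≡ ι n + 1ℚ
ι-suc n = trans (cong ι (ℕP.+-comm 1 n)) (ι-+ n 1)

ι-∸ : ∀ {m n} → n ≤ m → ι (m ℕ.∸ n) ≡ ι m - ι n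
ι-∸ {m} {n} n≤m = begin
  ι (m ℕ.∸ n)                  ≡⟨ solve 2 (λ a b → a := a :+ b :- b) refl (ι (m ℕ.∸ n)) (ι n) ⟩
  ι (m ℕ.∸ n) + ι n - ι n      ≡⟨ cong (_- ι n) (ι-+ (m ℕ.∸ n) n) ⟨
  ι (m ℕ.∸ n ℕ.+ n) - ι n      ≡⟨ cong (λ k → ι k - ι n) (ℕP.m∸n+n≡m n≤m) ⟩
  ι m - ι n                    ∎

ι-injective : ∀ {m n} → ι m ≡ ι n → m ≡ n
ι-injective {m} {n} ιm≡ιn = ℤP.+-injective (cong ℚ.↥_ (trans (sym (ι≡mkℚ m)) (trans ιm≡ιn (ι≡mkℚ n))))

ι-≢0 : ∀ {m} → 0 < m → ι m ≢ 0ℚ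
ι-≢0 {suc m} _ ι[1+m]≡0 with ι-injective {suc m} {0} ι[1+m]≡0
... | ()

ℤtoℚ-difference : ∀ {m n} → n ≤ m → ℤtoℚ (ℤ.+ m ℤ.- ℤ.+ n) ≡ ι (m ℕ.∸ n)
ℤtoℚ-difference {m} {n} n≤m = cong ℤtoℚ (trans (ℤP.m-n≡m⊖n m n) (ℤP.⊖-≥ n≤m))

ι-∏ : ∀ n (f : ℕ → ℕ) → ι (∏ℕ n f) ≡ ∏ n (ι ∘ f)
ι-∏ zero    f = refl
ι-∏ (suc n) f = trans (ι-* (∏ℕ n f) (f n)) (cong (_* ι (f n)) (ι-∏ n f))

ι-Δ : ∀ N (v : ℕ → ℕ) → (∀ {i j} → i < j → j < N → v j ≤ v i) → ι (Δℕ N v) ≡ Δ N (ι ∘ v)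
ι-Δ N v antitone = trans (ι-∏ N _) (∏-cong N (λ j j<N → trans (ι-∏ j _) (∏-cong j (λ i i<j → ι-∸ (antitone i<j j<N)))))

÷ℕ≡*inv : ∀ q {m} → 0 < m → q ÷ℕ m ≡ q * inv (ι m)
÷ℕ≡*inv q {suc k} _ = cong (q *_) (sym (inv-unique (ι (suc k)) _ (begin
  ι (suc k) * (ℤ.+ 1 ℚ./ suc k)  ≡⟨ cong₂ _*_ (ι≡mkℚ (suc k)) (ℚP.normalize-coprime (Coprimality.1-coprimeTo (suc k))) ⟩
  p * ℚ.1/ p                     ≡⟨ ℚP.*-inverseʳ p ⟩
  1ℚ                             ∎)))
  where p = ℚ.mkℚ (ℤ.+ suc k) 0 (Coprimality.sym (Coprimality.1-coprimeTo (suc k)))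

0÷ℕ : ∀ m → 0ℚ ÷ℕ m ≡ 0ℚ
0÷ℕ zero    = refl
0÷ℕ (suc m) = ℚP.*-zeroˡ (ℤ.+ 1 ℚ./ suc m)

÷ℕ-cancel : ∀ q {h d f} → h ℕ.* d ≡ f → 0 < f → q ÷ℕ h ≡ (ι d * q) ÷ℕ f
÷ℕ-cancel q {h} {d} {f} hd≡f 0<f = begin
  q ÷ℕ h                                       ≡⟨ ÷ℕ≡*inv q 0<h ⟩
  q * inv (ι h)                                ≡⟨ ℚP.*-identityʳ _ ⟨
  q * inv (ι h) * 1ℚ                           ≡⟨ cong (q * inv (ι h) *_) (*-inv (ι d) (ι-≢0 0<d)) ⟨
  q * inv (ι h) * (ι d * inv (ι d))
    ≡⟨ solve 4 (λ q h′ d d′ → q :* h′ :* (d :* d′) := d :* q :* (h′ :* d′)) refl q (inv (ι h)) (ι d) (inv (ι d)) ⟩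
  ι d * q * (inv (ι h) * inv (ι d))            ≡⟨ cong (ι d * q *_) (inv-* (ι h) (ι d) (ι-≢0 0<h) (ι-≢0 0<d)) ⟨
  ι d * q * inv (ι h * ι d)                    ≡⟨ cong (λ x → ι d * q * inv x) (trans (sym (ι-* h d)) (cong ι hd≡f)) ⟩
  ι d * q * inv (ι f)                          ≡⟨ ÷ℕ≡*inv (ι d * q) 0<f ⟨
  (ι d * q) ÷ℕ f                               ∎
  where
  0<h : 0 < h
  0<h = ℕP.n≢0⇒n>0 (λ h≡0 → ℕP.n>0⇒n≢0 0<f (trans (sym hd≡f) (cong (ℕ._* d) h≡0)))
  0<d : 0 < d
  0<d = ℕP.n≢0⇒n>0 (λ d≡0 → ℕP.n>0⇒n≢0 0<f (trans (sym hd≡f) (trans (cong (h ℕ.*_) d≡0) (ℕP.*-zeroʳ h))))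

φ-∏ : ∀ μ z → φ μ z ≡ ∏ (size μ) (λ i → z + ι (beta (size μ) μ i))
φ-∏ μ z = trans (prodℚ-map-applyUpTo s _ (λ i → i)) (∏-cong s (λ i i<s → cong (z +_) (factor i i<s)))
  where
  s = size μ
  factor : ∀ i → i < s → ℤtoℚ (ℤ.+ (s ℕ.+ part μ i) ℤ.- ℤ.+ suc i) ≡ ι (beta s μ i)
  factor i i<s = trans (ℤtoℚ-difference (≤-trans i<s (ℕP.m≤m+n s (part μ i))))
                       (cong ι (trans (cong (ℕ._∸ suc i) (+-comm s (part μ i))) (ℕP.+-∸-assoc (part μ i) i<s)))

ι-∏!-raise : ∀ N k v → k < N → ι (∏ℕ N (λ i → raise k v i !)) ≡ ι (∏ℕ N (λ i → v i !)) * (ι (v k) + 1ℚ)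
ι-∏!-raise N k v k<N = begin
  ι (∏ℕ N (λ i → raise k v i !))
    ≡⟨ trans (ι-∏ N _) (∏-split-at N _ k<N) ⟩
  ∏ N (except k (λ i → ι (raise k v i !))) * ι (raise k v k !)
    ≡⟨ cong₂ _*_ (∏-except-cong k N (λ i _ i≢k → cong (λ m → ι (m !)) (raise-≢ v i≢k))) (cong (λ m → ι (m !)) (raise-self k v)) ⟩
  R * ι (suc (v k) ℕ.* v k !)
    ≡⟨ cong (R *_) (trans (ι-* (suc (v k)) (v k !)) (cong (_* ι (v k !)) (ι-suc (v k)))) ⟩
  R * ((ι (v k) + 1ℚ) * ι (v k !))
    ≡⟨ solve 3 (λ r s f → r :* (s :* f) := r :* f :* s) refl R (ι (v k) + 1ℚ) (ι (v k !)) ⟩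
  R * ι (v k !) * (ι (v k) + 1ℚ)
    ≡⟨ cong (_* (ι (v k) + 1ℚ)) (trans (ι-∏ N _) (∏-split-at N _ k<N)) ⟨
  ι (∏ℕ N (λ i → v i !)) * (ι (v k) + 1ℚ) ∎
  where R = ∏ N (except k (λ i → ι (v i !)))

DependsOnFirst : ℕ → ((ℕ → ℕ) → ℚ) → Set
DependsOnFirst N F = ∀ {v w} → (∀ i → i < N → v i ≡ w i) → F v ≡ F w

VanishesOnTies : ℕ → ((ℕ → ℕ) → ℚ) → Set
VanishesOnTies N F = ∀ v {i} → suc i < N → v i ≡ v (suc i) → F v ≡ 0ℚ

-- y is the length of the row above, whose β-number in a sequence of length 1 + N is y + N
VanishesAt : Maybe ℕ → ℕ → ((ℕ → ℕ) → ℚ) → Set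
VanishesAt nothing  N F = ⊤
VanishesAt (just y) N F = ∀ v → v 0 ≡ y ℕ.+ N → F v ≡ 0ℚ

sum-addBoxesFrom : ∀ p l N (F : (ℕ → ℕ) → ℚ) → Decreasing l → FitsUnder p l → length l < N →
  DependsOnFirst N F → VanishesOnTies N F → VanishesAt p N F →
  sumℚ (map (F ∘ beta N) (addBoxesFrom p l)) ≡ ∑ N (λ k → F (raise k (beta N l)))
sum-addBoxesFrom p [] (suc M) F _ _ _ depends ties _ = sym (begin
  ∑ (suc M) (λ k → F (raise k β))                  ≡⟨ ∑-suc M _ ⟩
  F (raise 0 β) + ∑ M (λ k → F (raise (suc k) β))  ≡⟨ cong₂ _+_ (depends new-row) (∑-zero M (λ k k<M → ties _ (s≤s k<M) (tie k<M))) ⟩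
  F (beta (suc M) [ 1 ]) + 0ℚ                      ∎)
  where
  β = beta (suc M) []
  new-row : ∀ i → i < suc M → raise 0 β i ≡ beta (suc M) [ 1 ] i
  new-row zero    _ = raise-self 0 β
  new-row (suc i) _ = raise-≢ {0} {suc i} β (λ ())
  tie : ∀ {k} → k < M → raise (suc k) β k ≡ raise (suc k) β (suc k)
  tie {k} k<M = trans (raise-≢ β (ℕP.<⇒≢ (ℕP.n<1+n k))) (trans (ℕP.+-∸-assoc 1 k<M) (sym (raise-self (suc k) β)))
sum-addBoxesFrom p (x ∷ xs) (suc M) F (xs₀≤x , xs↓) fits (s≤s length<M) depends ties vanishes = by-growth p fits vanishes
  where
  β = beta (suc M) (x ∷ xs)
  L = addBoxesFrom (just x) xs

  F′ : (ℕ → ℕ) → ℚ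
  F′ v = F ((x ℕ.+ M) ◂ v)

  lower-rows : sumℚ (map (F ∘ beta (suc M)) (map (x ∷_) L)) ≡ ∑ M (λ k → F (raise (suc k) β))
  lower-rows = begin
    sumℚ (map (F ∘ beta (suc M)) (map (x ∷_) L))   ≡⟨ cong sumℚ (map-∘ L) ⟨
    sumℚ (map (λ μ → F (beta (suc M) (x ∷ μ))) L)  ≡⟨ cong sumℚ (map-cong (λ μ → depends (λ { zero _ → refl ; (suc i) _ → refl })) L) ⟩
    sumℚ (map (F′ ∘ beta M) L)
      ≡⟨ sum-addBoxesFrom (just x) xs M F′ xs↓ xs₀≤x length<M
           (λ v≗w → depends (λ { zero _ → refl ; (suc i) (s≤s i<M) → v≗w i i<M }))
           (λ v 1+i<M tie → ties _ (s≤s 1+i<M) tie)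
           (λ v v₀≡x+M → ties _ (s≤s (≤-trans (s≤s z≤n) length<M)) (sym v₀≡x+M)) ⟩
    ∑ M (λ k → F′ (raise k (beta M xs)))
      ≡⟨ ∑-cong M (λ k _ → depends (λ { zero _ → sym (raise-≢ {suc k} {0} β (λ ())) ; (suc i) _ → sym (raise-suc k β i) })) ⟩
    ∑ M (λ k → F (raise (suc k) β)) ∎

  with-first-row : F (beta (suc M) (suc x ∷ xs)) + sumℚ (map (F ∘ beta (suc M)) (map (x ∷_) L))
                   ≡ ∑ (suc M) (λ k → F (raise k β))
  with-first-row = begin
    F (beta (suc M) (suc x ∷ xs)) + sumℚ (map (F ∘ beta (suc M)) (map (x ∷_) L))
      ≡⟨ cong₂ _+_ (depends (λ { zero _ → sym (raise-self 0 β) ; (suc i) _ → sym (raise-≢ {0} {suc i} β (λ ())) })) lower-rows ⟩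
    F (raise 0 β) + ∑ M (λ k → F (raise (suc k) β))
      ≡⟨ ∑-suc M _ ⟨
    ∑ (suc M) (λ k → F (raise k β)) ∎

  by-growth : ∀ p → FitsUnder p (x ∷ xs) → VanishesAt p (suc M) F →
              sumℚ (map (F ∘ beta (suc M)) (addBoxesFrom p (x ∷ xs))) ≡ ∑ (suc M) (λ k → F (raise k β))
  by-growth nothing  _   _        = with-first-row
  by-growth (just y) x≤y vanishes with x <ᵇ y in x<ᵇy
  ... | true  = with-first-row
  ... | false = begin
    sumℚ (map (F ∘ beta (suc M)) (map (x ∷_) L))       ≡⟨ lower-rows ⟩
    ∑ M (λ k → F (raise (suc k) β))                    ≡⟨ ℚP.+-identityˡ _ ⟨
    0ℚ + ∑ M (λ k → F (raise (suc k) β))               ≡⟨ cong (_+ ∑ M (λ k → F (raise (suc k) β))) (vanishes (raise 0 β) reaches-above) ⟨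
    F (raise 0 β) + ∑ M (λ k → F (raise (suc k) β))    ≡⟨ ∑-suc M _ ⟨
    ∑ (suc M) (λ k → F (raise k β))                    ∎
    where
    x≡y : x ≡ y
    x≡y = ℕP.≤-antisym x≤y (ℕP.≮⇒≥ (λ x<y → subst T x<ᵇy (<⇒<ᵇ x<y)))
    reaches-above : raise 0 β 0 ≡ y ℕ.+ suc M
    reaches-above = trans (raise-self 0 β) (trans (sym (+-suc x M)) (cong (ℕ._+ suc M) x≡y))

module AtPartition (l : List ℕ) (l↓ : Decreasing l) (l⁺ : All (0 <_) l) (z : ℚ) where

  n N : ℕ
  n = size l
  N = suc n

  b : ℕ → ℕ
  b = beta N l

  length≤n : length l ≤ n
  length≤n = length≤size l l⁺

  F : (ℕ → ℕ) → ℚ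
  F v = (Δ N (ι ∘ v) * ∏ N (λ i → z + ι (v i))) ÷ℕ ∏ℕ N (λ i → v i !)

  ∏!-positive : ∀ (v : ℕ → ℕ) → 0 < ∏ℕ N (λ i → v i !)
  ∏!-positive v = ∏ℕ-positive N {λ i → v i !} (λ i → ℕP.1≤n! (v i))

  inv∏b! : ℚ
  inv∏b! = inv (ι (∏ℕ N (λ i → b i !)))

  φ≡F∘beta : ∀ μ → OneBoxMore nothing l μ → φ μ z ÷ℕ H μ ≡ F (beta N μ)
  φ≡F∘beta μ μ⁺ = begin
    φ μ z ÷ℕ H μ
      ≡⟨ cong (_÷ℕ H μ) (trans (φ-∏ μ z) (cong (λ s → ∏ s (λ i → z + ι (beta s μ i))) size-suc)) ⟩
    ∏ N (λ i → z + ι (beta N μ i)) ÷ℕ H μ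
      ≡⟨ ÷ℕ-cancel (∏ N (λ i → z + ι (beta N μ i))) {H μ}
                   (frobenius N μ isDecreasing (≤-trans length≤ (s≤s length≤n))) (∏!-positive (beta N μ)) ⟩
    (ι (Δℕ N (beta N μ)) * ∏ N (λ i → z + ι (beta N μ i))) ÷ℕ ∏ℕ N (λ i → beta N μ i !)
      ≡⟨ cong (λ d → (d * ∏ N (λ i → z + ι (beta N μ i))) ÷ℕ ∏ℕ N (λ i → beta N μ i !))
              (ι-Δ N (beta N μ) (λ i<j j<N → <⇒≤ (beta-strict N μ isDecreasing i<j j<N))) ⟩
    F (beta N μ) ∎
    where open OneBoxMore μ⁺

  F-depends : DependsOnFirst N F
  F-depends v≗w = cong₂ _÷ℕ_
    (cong₂ _*_ (Δ-cong N (λ i i<N → cong ι (v≗w i i<N))) (∏-cong N (λ i i<N → cong (λ m → z + ι m) (v≗w i i<N))))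
    (∏ℕ-cong N (λ i i<N → cong _! (v≗w i i<N)))

  F-ties : VanishesOnTies N F
  F-ties v 1+i<N tie = trans
    (cong (λ d → (d * ∏ N (λ i → z + ι (v i))) ÷ℕ ∏ℕ N (λ i → v i !)) (Δ-tie N (ι ∘ v) 1+i<N (cong ι tie)))
    (trans (cong (_÷ℕ ∏ℕ N (λ i → v i !)) (ℚP.*-zeroˡ (∏ N (λ i → z + ι (v i))))) (0÷ℕ (∏ℕ N (λ i → v i !))))

  sum-over-addBoxes : sumℚ (map (λ μ → φ μ z ÷ℕ H μ) (addBoxes l)) ≡ ∑ N (λ k → F (raise k b))
  sum-over-addBoxes = trans
    (cong sumℚ (map-cong-local (All.map (λ {μ} → φ≡F∘beta μ) (addBoxesFrom-oneBoxMore nothing l l↓ l⁺ tt tt))))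
    (sum-addBoxesFrom nothing l N F l↓ tt (s≤s length≤n) F-depends F-ties tt)

  ιb : ℕ → ℚ
  ιb = ι ∘ b

  W : ℕ → ℕ → ℚ
  W k i = ι (raise k b i)

  W-self : ∀ k → W k k ≡ ιb k + 1ℚ
  W-self k = trans (cong ι (raise-self k b)) (ι-suc (b k))

  W-other : ∀ k i → i ≢ k → W k i ≡ ιb i
  W-other k i i≢k = cong ι (raise-≢ b i≢k)

  ιb-last : ιb n ≡ 0ℚ
  ιb-last = cong ι (beta-last n l length≤n)

  ιb-distinct : ∀ i j → i < N → j < N → i ≢ j → ιb i - ιb j ≢ 0ℚ
  ιb-distinct i j i<N j<N i≢j ιbᵢ-ιbⱼ≡0 =
    i≢j (beta-injective N l l↓ i<N j<N (ι-injective (x∙y⁻¹≈ε⇒x≈y (ιb i) (ιb j) ιbᵢ-ιbⱼ≡0)))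

  ιb+1≢0 : ∀ k → ιb k + 1ℚ ≢ 0ℚ
  ιb+1≢0 k = subst (_≢ 0ℚ) (ι-suc (b k)) (ι-≢0 {suc (b k)} (s≤s z≤n))

  open Raising ιb n W W-self W-other ιb-last ιb-distinct (λ k _ → ιb+1≢0 k) using (∑-raised)

  F-raise : ∀ k → k < N → F (raise k b) ≡ Δ N (W k) * ∏ N (λ i → z + W k i) * inv (ιb k + 1ℚ) * inv∏b!
  F-raise k k<N = begin
    F (raise k b)
      ≡⟨ ÷ℕ≡*inv _ (∏!-positive (raise k b)) ⟩
    Δ N (W k) * ∏ N (λ i → z + W k i) * inv (ι (∏ℕ N (λ i → raise k b i !)))
      ≡⟨ cong (λ x → Δ N (W k) * ∏ N (λ i → z + W k i) * inv x) (ι-∏!-raise N k b k<N) ⟩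
    Δ N (W k) * ∏ N (λ i → z + W k i) * inv (ι (∏ℕ N (λ i → b i !)) * (ιb k + 1ℚ))
      ≡⟨ cong (Δ N (W k) * ∏ N (λ i → z + W k i) *_) (inv-* _ _ (ι-≢0 (∏!-positive b)) (ιb+1≢0 k)) ⟩
    Δ N (W k) * ∏ N (λ i → z + W k i) * (inv∏b! * inv (ιb k + 1ℚ))
      ≡⟨ solve 4 (λ a p c r → a :* p :* (c :* r) := a :* p :* r :* c) refl (Δ N (W k)) (∏ N (λ i → z + W k i)) inv∏b! (inv (ιb k + 1ℚ)) ⟩
    Δ N (W k) * ∏ N (λ i → z + W k i) * inv (ιb k + 1ℚ) * inv∏b! ∎

  ιb-lower : ∀ i → i < n → ιb i - 1ℚ ≡ ι (beta n l i)
  ιb-lower i i<n = begin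
    ιb i - 1ℚ                 ≡⟨ cong (λ m → ι m - 1ℚ) (beta-suc n l i<n) ⟩
    ι (suc (beta n l i)) - 1ℚ ≡⟨ cong (_- 1ℚ) (ι-suc (beta n l i)) ⟩
    ι (beta n l i) + 1ℚ - 1ℚ  ≡⟨ solve 1 (λ x → x :+ con 1ℚ :- con 1ℚ := x) refl (ι (beta n l i)) ⟩
    ι (beta n l i)            ∎

  φ-at-z : φ l z ≡ ∏ n (λ i → z + (ιb i - 1ℚ))
  φ-at-z = trans (φ-∏ l z) (∏-cong n (λ i i<n → cong (z +_) (sym (ιb-lower i i<n))))

  φ-at-z+1 : z * φ l (z + 1ℚ) ≡ ∏ N (λ i → z + ιb i)
  φ-at-z+1 = begin
    z * φ l (z + 1ℚ)                          ≡⟨ cong (z *_) (trans (φ-∏ l (z + 1ℚ)) (∏-cong n shift)) ⟩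
    z * ∏ n (λ i → z + ιb i)                  ≡⟨ ℚP.*-comm z _ ⟩
    ∏ n (λ i → z + ιb i) * z                  ≡⟨ cong (λ x → ∏ n (λ i → z + ιb i) * x) (ℚP.+-identityʳ z) ⟨
    ∏ n (λ i → z + ιb i) * (z + 0ℚ)           ≡⟨ cong (λ m → ∏ n (λ i → z + ιb i) * (z + ι m)) (beta-last n l length≤n) ⟨
    ∏ N (λ i → z + ιb i)                      ∎
    where
    shift : ∀ i → i < n → z + 1ℚ + ι (beta n l i) ≡ z + ιb i
    shift i i<n = trans (cong (z + 1ℚ +_) (sym (ιb-lower i i<n)))
                        (solve 2 (λ z x → z :+ con 1ℚ :+ (x :- con 1ℚ) := z :+ x) refl z (ιb i))

  sum-F-raise : ∑ N (λ k → F (raise k b)) ≡ Δ N ιb * (z * φ l (z + 1ℚ) + φ l z) * inv∏b!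
  sum-F-raise = begin
    ∑ N (λ k → F (raise k b))
      ≡⟨ ∑-cong N F-raise ⟩
    ∑ N (λ k → Δ N (W k) * ∏ N (λ i → z + W k i) * inv (ιb k + 1ℚ) * inv∏b!)
      ≡⟨ ∑-*ʳ N inv∏b! _ ⟨
    ∑ N (λ k → Δ N (W k) * ∏ N (λ i → z + W k i) * inv (ιb k + 1ℚ)) * inv∏b!
      ≡⟨ cong (_* inv∏b!) (∑-raised z) ⟩
    Δ N ιb * (∏ N (λ i → z + ιb i) + ∏ n (λ i → z + (ιb i - 1ℚ))) * inv∏b!
      ≡⟨ cong₂ (λ x y → Δ N ιb * (x + y) * inv∏b!) (sym φ-at-z+1) (sym φ-at-z) ⟩
    Δ N ιb * (z * φ l (z + 1ℚ) + φ l z) * inv∏b! ∎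

  H-positive : 0 < H l
  H-positive = ℕP.n≢0⇒n>0 (λ H≡0 → ℕP.n>0⇒n≢0 (∏!-positive b)
    (trans (sym (frobenius N l l↓ (ℕP.m≤n⇒m≤1+n length≤n))) (cong (ℕ._* Δℕ N b) H≡0)))

  inv-H : inv (ι (H l)) ≡ Δ N ιb * inv∏b!
  inv-H = inv-unique (ι (H l)) _ (begin
    ι (H l) * (Δ N ιb * inv∏b!)          ≡⟨ ℚP.*-assoc (ι (H l)) _ _ ⟨
    ι (H l) * Δ N ιb * inv∏b!            ≡⟨ cong (λ d → ι (H l) * d * inv∏b!) (ι-Δ N b (λ i<j j<N → <⇒≤ (beta-strict N l l↓ i<j j<N))) ⟨
    ι (H l) * ι (Δℕ N b) * inv∏b!
      ≡⟨ cong (_* inv∏b!) (trans (sym (ι-* (H l) (Δℕ N b))) (cong ι (frobenius N l l↓ (ℕP.m≤n⇒m≤1+n length≤n)))) ⟩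
    ι (∏ℕ N (λ i → b i !)) * inv∏b!      ≡⟨ *-inv _ (ι-≢0 (∏!-positive b)) ⟩
    1ℚ                                   ∎)

theorem4p1 : (λp : Partition) (z : ℚ) →
    D (λ μ → φ μ z ÷ℕ H μ) (parts λp) ≡ (z * φ (parts λp) (z + 1ℚ)) ÷ℕ H (parts λp)
theorem4p1 λp z = begin
  sumℚ (map (λ μ → φ μ z ÷ℕ H μ) (addBoxes l)) - φ l z ÷ℕ H l
    ≡⟨ cong₂ _-_ (trans sum-over-addBoxes sum-F-raise) (trans (÷ℕ≡*inv _ H-positive) (cong (φ l z *_) inv-H)) ⟩
  Δ N ιb * (z * φ l (z + 1ℚ) + φ l z) * inv∏b! - φ l z * (Δ N ιb * inv∏b!)
    ≡⟨ solve 5 (λ d z p q c → d :* (z :* p :+ q) :* c :- q :* (d :* c) := z :* p :* (d :* c))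
               refl (Δ N ιb) z (φ l (z + 1ℚ)) (φ l z) inv∏b! ⟩
  z * φ l (z + 1ℚ) * (Δ N ιb * inv∏b!)
    ≡⟨ cong (z * φ l (z + 1ℚ) *_) inv-H ⟨
  z * φ l (z + 1ℚ) * inv (ι (H l))
    ≡⟨ ÷ℕ≡*inv _ H-positive ⟨
  (z * φ l (z + 1ℚ)) ÷ℕ H l ∎
  where
  l = parts λp
  open AtPartition l (linked⇒decreasing l (decreasing λp)) (positive λp) z
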